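{- Let $q$ be a power of an odd prime, let $n\ge 2$ be an even integer, and let $a,c\in\mathbb{F}_q$, not both zero. Let $f:\mathbb{F}_{q^2}\to\mathbb{F}_{q^2}$ be given by $f(X)=(cX^q+aX)(X^q-X)^{n-1}$. Fix $\beta\in\mathbb{F}_{q^2}\setminus\mathbb{F}_q$ with $\beta^2\in\mathbb{F}_q$, and put $\delta_2=(a+c)(-2)^{n-1}\beta^{n-2}$. Write $\mathfrak{g}(m)=\gcd(m,q-1)$. If $\delta_2=0$, then the functional graph of $f$ on $\mathbb{F}_{q^2}$ has exactly one connected component. Moreover, it consists of a cycle of length one (the fixed point $0$) with $q-1$ other vertices directed to it, and among these $q-1$ vertices, $\frac{q-1}{\mathfrak{g}(n)}$ of them have exactly $q\,\mathfrak{g}(n)$ vertices in their preimage.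
   Context: The functional graph of a map $f:\mathbb{F}_{q^2}\to\mathbb{F}_{q^2}$ is the directed graph with vertex set $\mathbb{F}_{q^2}$ and an edge $x\to f(x)$ for each $x$; connected components are those of the underlying undirected graph. The preimage of $\alpha$ is $f^{ -1}(\alpha)=\{x: f(x)=\alpha\}$. A vertex $x$ is "directed to" $\alpha$ if $f(x)=\alpha$. -}

module Defs where

open import Level using (0ℓ)
open import Data.Nat using (ℕ; zero; suc; _∸_)
open import Data.List using (List; length; filter)
open import Data.List.Membership.Propositional using (_∈_)
open import Data.List.Relation.Unary.Unique.Propositional using (Unique)
open import Relation.Binary.PropositionalEquality using (_≡_; _≢_)
open import Relation.Binary.Definitions using (DecidableEquality)
open import Relation.Unary using (Pred; Decidable)
open import Relation.Binary.Construct.Closure.Equivalence using (EqClosure)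
open import Algebra.Structures using (IsCommutativeRing)
open import Data.Product using (∃)

record FiniteField : Set₁ where
  infixl 6 _+_
  infixl 7 _*_
  infix 8 -_
  field
    Carrier       : Set
    _≟_           : DecidableEquality Carrier
    _+_ _*_       : Carrier → Carrier → Carrier
    -_            : Carrier → Carrier
    0# 1#         : Carrier
    isCommRing    : IsCommutativeRing _≡_ _+_ _*_ -_ 0# 1#
    0≢1           : 0# ≢ 1#
    inverse       : ∀ x → x ≢ 0# → ∃ λ y → x * y ≡ 1#
    elems         : List Carrier
    elems-unique  : Unique elems
    elems-complete : ∀ x → x ∈ elems

module FF (K : FiniteField) where
  open FiniteField K public

  infixl 6 _-_
  _-_ : Carrier → Carrier → Carrier
  x - y = x + (- y)

  infixr 8 _^ᶠ_
  _^ᶠ_ : Carrier → ℕ → Carrier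
  x ^ᶠ zero = 1#
  x ^ᶠ suc m = x * (x ^ᶠ m)

  card : ℕ
  card = length elems

  -- membership in the subfield F_q = { x | x^q = x } of F_{q^2}
  InFq : ℕ → Carrier → Set
  InFq q x = x ^ᶠ q ≡ x

  fMap : (q n : ℕ) (a c : Carrier) → Carrier → Carrier
  fMap q n a c X = (c * X ^ᶠ q + a * X) * (X ^ᶠ q - X) ^ᶠ (n ∸ 1)

  δ₂ : (n : ℕ) (a c β : Carrier) → Carrier
  δ₂ n a c β = (a + c) * (- (1# + 1#)) ^ᶠ (n ∸ 1) * β ^ᶠ (n ∸ 2)

  count : (P : Pred Carrier 0ℓ) → Decidable P → ℕ
  count P P? = length (filter P? elems)

  preimageSize : (Carrier → Carrier) → Carrier → ℕ
  preimageSize f α = count (λ x → f x ≡ α) (λ x → f x ≟ α)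

  iter : (Carrier → Carrier) → ℕ → Carrier → Carrier
  iter f zero x = x
  iter f (suc k) x = f (iter f k x)

  Edge : (Carrier → Carrier) → Carrier → Carrier → Set
  Edge f x y = f x ≡ y

  Connected : (Carrier → Carrier) → Carrier → Carrier → Set
  Connected f = EqClosure (Edge f)

{-# OPTIONS --safe #-}
module Submission where

-- Since p is odd and β ≠ 0, δ₂ = 0 forces c = -a, so f = -a Tⁿ with T(X) = X^q - X.  In
-- characteristic p, X ↦ X^q is additive, and it is an involution since x^{q²} = x.  Hence T is
-- F_q-linear with kernel F_q and image V = {y | y^q = -y} = β F_q, and as n is even, f maps
-- everything into F_q and F_q to 0.  So f ∘ f = 0, which gives one component whose only cycle is
-- the fixed point 0, and f⁻¹(0) = F_q.  For α ∈ F_q*, f⁻¹(α) = T⁻¹(β S) with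
-- S = {t ∈ F_q* | γ tⁿ = α}, γ = -a βⁿ, so |f⁻¹(α)| = q |S|.  A nonempty S is a coset of the
-- n-th roots of unity in F_q*, which by Bézout are the g-th roots for g = gcd(n, q-1).  There are
-- exactly g of them: at most g as X^g - 1 has at most g roots, and at least g because t ↦ t^g maps
-- F_q* into the at most (q-1)/g roots of X^{(q-1)/g} - 1, with fibres that are cosets of the g-th
-- roots.  Counting F_q* by the fibres of t ↦ γ tⁿ, all of size 0 or g, gives the last claim.

open import Defs
open import Data.Nat using (ℕ)
open import Relation.Binary.PropositionalEquality using (_≡_)
import Algebra.Structures

module NatLemmas where
  open import Data.Nat using (zero; suc; _+_; _*_; _<_; _/_; _%_; s≤s)
  open import Data.Nat.DivMod using (m≡m%n+[m/n]*n; m%n<n)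
  open import Data.Nat.Properties using (+-identityʳ; *-identityʳ; *-zeroʳ; *-comm; +-comm; <⇒≱; <⇒≢; <-cmp; *-mono-<)
  open import Data.Nat.Divisibility using (_∣_; divides; ∣⇒≤; m%n≡0⇒n∣m)
  open import Data.Nat.Primality using (Prime; euclidsLemma; prime⇒irreducible)
  open import Data.Nat.Combinatorics using (_C_; nC1≡n; nCk+nC[k+1]≡[n+1]C[k+1])
  open import Data.Nat.Tactic.RingSolver using (solve-∀)
  open import Data.Sum using (inj₁; inj₂)
  open import Data.Empty using (⊥-elim)
  open import Relation.Nullary using (¬_)
  open import Relation.Binary.Definitions using (tri<; tri≈; tri>)
  open import Relation.Binary.PropositionalEquality

  [1+k]*[1+n]C[1+k]≡[1+n]*nCk : ∀ n k → suc k * (suc n C suc k) ≡ suc n * (n C k)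
  [1+k]*[1+n]C[1+k]≡[1+n]*nCk zero zero = refl
  [1+k]*[1+n]C[1+k]≡[1+n]*nCk zero (suc k) = *-zeroʳ (suc (suc k))
  [1+k]*[1+n]C[1+k]≡[1+n]*nCk (suc n) zero = trans (+-identityʳ _) (trans (nC1≡n (suc (suc n))) (sym (*-identityʳ _)))
  [1+k]*[1+n]C[1+k]≡[1+n]*nCk (suc n) (suc k) = begin
    suc (suc k) * (suc (suc n) C suc (suc k))  ≡⟨ cong (suc (suc k) *_) (nCk+nC[k+1]≡[n+1]C[k+1] (suc n) (suc k)) ⟨
    suc (suc k) * (c + d)                       ≡⟨ split (suc k) c d ⟩
    suc k * c + c + suc (suc k) * d
      ≡⟨ cong₂ (λ u v → u + c + v) ([1+k]*[1+n]C[1+k]≡[1+n]*nCk n k) ([1+k]*[1+n]C[1+k]≡[1+n]*nCk n (suc k)) ⟩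
    suc n * a + c + suc n * b                   ≡⟨ merge (suc n) a b c ⟩
    suc n * (a + b) + c                         ≡⟨ cong (λ u → suc n * u + c) (nCk+nC[k+1]≡[n+1]C[k+1] n k) ⟩
    suc n * c + c                               ≡⟨ +-comm (suc n * c) c ⟩
    suc (suc n) * c                             ∎
    where
    open ≡-Reasoning
    a = n C k
    b = n C suc k
    c = suc n C suc k
    d = suc n C suc (suc k)
    split : ∀ k c d → suc k * (c + d) ≡ k * c + c + suc k * d
    split = solve-∀
    merge : ∀ n a b c → n * a + c + n * b ≡ n * (a + b) + c
    merge = solve-∀

  prime∣pCk : ∀ {p k} → Prime p → 0 < k → k < p → p ∣ p C k
  prime∣pCk {suc n} {suc k} p-prime _ k<p with euclidsLemma (suc k) (suc n C suc k) p-prime p∣[1+k]*pCk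
    where
    p∣[1+k]*pCk : suc n ∣ suc k * (suc n C suc k)
    p∣[1+k]*pCk = divides (n C k) (trans ([1+k]*[1+n]C[1+k]≡[1+n]*nCk n k) (*-comm (suc n) (n C k)))
  ... | inj₁ p∣1+k = ⊥-elim (<⇒≱ k<p (∣⇒≤ p∣1+k))
  ... | inj₂ p∣pCk = p∣pCk

  m*m≡n*n⇒m≡n : ∀ {m n} → m * m ≡ n * n → m ≡ n
  m*m≡n*n⇒m≡n {m} {n} m²≡n² with <-cmp m n
  ... | tri< m<n _ _ = ⊥-elim (<⇒≢ (*-mono-< m<n m<n) m²≡n²)
  ... | tri≈ _ m≡n _ = m≡n
  ... | tri> _ _ m>n = ⊥-elim (<⇒≢ (*-mono-< m>n m>n) (sym m²≡n²))

  odd-prime : ∀ {p} → Prime p → p ≢ 2 → p ≡ suc (p / 2 * 2)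
  odd-prime {p} p-prime p≢2 = trans (m≡m%n+[m/n]*n p 2) (cong (_+ p / 2 * 2) p%2≡1)
    where
    2∤p : ¬ 2 ∣ p
    2∤p 2∣p with prime⇒irreducible p-prime 2∣p
    ... | inj₁ ()
    ... | inj₂ 2≡p = p≢2 (sym 2≡p)
    p%2≡1 : p % 2 ≡ 1
    p%2≡1 with p % 2 | m%n<n p 2 | m%n≡0⇒n∣m p 2
    ... | zero | _ | 2∣p = ⊥-elim (2∤p (2∣p refl))
    ... | suc zero | _ | _ = refl
    ... | suc (suc _) | s≤s (s≤s ()) | _

module Counting where
  open import Level using (0ℓ)
  open import Algebra.Core using (Op₂)
  open import Algebra.Structures using (IsCommutativeMonoid)
  open import Algebra.Bundles using (CommutativeMonoid)
  import Algebra.Properties.CommutativeSemigroup as CommutativeSemigroupProperties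
  open import Data.Bool using (true; false; if_then_else_)
  open import Data.Nat as ℕ using (ℕ; suc; _+_; _*_; _≤_; z≤n)
  import Data.Nat.Properties as ℕP
  open import Data.Nat.ListAction using (sum)
  open import Data.List using (List; []; _∷_; map; foldr; filter; length)
  open import Data.List.Properties using (map-∘; map-cong; filter-≐; filter-all; filter-none; filter-accept; filter-reject)
  open import Data.List.Membership.Propositional using (_∈_)
  open import Data.List.Membership.Propositional.Properties using (∈-map⁺; ∈-map⁻; ∈-filter⁺; ∈-filter⁻)
  open import Data.List.Membership.Propositional.Properties.WithK using (unique∧set⇒bag)
  open import Data.List.Relation.Unary.All as All using ([]; _∷_)
  open import Data.List.Relation.Unary.All.Properties using (all-filter)
  open import Data.List.Relation.Unary.Any using (here; there)
  open import Data.List.Relation.Unary.AllPairs using (_∷_)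
  open import Data.List.Relation.Unary.Unique.Propositional using (Unique)
  import Data.List.Relation.Unary.Unique.Propositional.Properties as Unique
  open import Data.List.Relation.Binary.BagAndSetEquality using (∼bag⇒↭)
  open import Data.List.Relation.Binary.Permutation.Propositional using (_↭_; ↭⇒↭ₛ)
  import Data.List.Relation.Binary.Permutation.Propositional.Properties as ↭
  open import Data.List.Relation.Binary.Permutation.Setoid.Properties using (foldr-commMonoid)
  open import Data.Product using (_×_; _,_; proj₂; ∃)
  open import Data.Sum using (_⊎_; inj₁; inj₂)
  open import Data.Empty using (⊥-elim)
  open import Function using (_∘_; const; mk⇔)
  open import Relation.Nullary using (Dec; yes; no; ¬_; does)
  open import Relation.Nullary.Decidable using (_×-dec_; ¬?)
  open import Relation.Unary using (Pred; Decidable; _≐_)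
  open import Relation.Binary.Definitions using (DecidableEquality)
  open import Relation.Binary.PropositionalEquality

  module _ {M : Set} {_∙_ : Op₂ M} {ε : M} (isCM : IsCommutativeMonoid _≡_ _∙_ ε) {A : Set} where
    open IsCommutativeMonoid isCM using (identityˡ)

    private
      commutativeMonoid : CommutativeMonoid 0ℓ 0ℓ
      commutativeMonoid = record { isCommutativeMonoid = isCM }
      open CommutativeSemigroupProperties (CommutativeMonoid.commutativeSemigroup commutativeMonoid) using (interchange)

    foldr-reindex : ∀ (f : A → M) {h : A → A} {L} → map h L ↭ L → foldr _∙_ ε (map (f ∘ h) L) ≡ foldr _∙_ ε (map f L)
    foldr-reindex f {h} {L} hL↭L =
      trans (cong (foldr _∙_ ε) (map-∘ L)) (foldr-commMonoid (setoid M) isCM (↭⇒↭ₛ (↭.map⁺ f hL↭L)))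

    foldr-map-∙ : ∀ (f g : A → M) xs →
      foldr _∙_ ε (map (λ x → f x ∙ g x) xs) ≡ foldr _∙_ ε (map f xs) ∙ foldr _∙_ ε (map g xs)
    foldr-map-∙ f g [] = sym (identityˡ ε)
    foldr-map-∙ f g (x ∷ xs) = trans (cong ((f x ∙ g x) ∙_) (foldr-map-∙ f g xs)) (interchange _ _ _ _)

  𝟙 : ∀ {P : Set} → Dec P → ℕ
  𝟙 d = if does d then 1 else 0

  module _ {A : Set} where

    ↭-map-bijection : ∀ {L : List A} → Unique L → (h h⁻¹ : A → A) →
      (∀ x → h⁻¹ (h x) ≡ x) → (∀ y → h (h⁻¹ y) ≡ y) →
      (∀ {x} → x ∈ L → h x ∈ L) → (∀ {y} → y ∈ L → h⁻¹ y ∈ L) → map h L ↭ L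
    ↭-map-bijection {L} L! h h⁻¹ left right h∈ h⁻¹∈ =
      ∼bag⇒↭ (unique∧set⇒bag (Unique.map⁺ injective L!) L! (mk⇔ to from))
      where
      injective : ∀ {x y} → h x ≡ h y → x ≡ y
      injective {x} {y} hx≡hy = trans (sym (left x)) (trans (cong h⁻¹ hx≡hy) (left y))
      to : ∀ {y} → y ∈ map h L → y ∈ L
      to y∈ with ∈-map⁻ h y∈
      ... | x , x∈ , refl = h∈ x∈
      from : ∀ {y} → y ∈ L → y ∈ map h L
      from y∈ = subst (_∈ map h L) (right _) (∈-map⁺ h (h⁻¹∈ y∈))

    module _ {P : Pred A 0ℓ} (P? : Decidable P) where

      length-filter-∷ : ∀ x xs → length (filter P? (x ∷ xs)) ≡ 𝟙 (P? x) + length (filter P? xs)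
      length-filter-∷ x xs with does (P? x)
      ... | true = refl
      ... | false = refl

      length-filter≡sum-𝟙 : ∀ xs → length (filter P? xs) ≡ sum (map (𝟙 ∘ P?) xs)
      length-filter≡sum-𝟙 [] = refl
      length-filter≡sum-𝟙 (x ∷ xs) = trans (length-filter-∷ x xs) (cong (𝟙 (P? x) +_) (length-filter≡sum-𝟙 xs))

      length-filter-split : ∀ {Q : Pred A 0ℓ} (Q? : Decidable Q) xs → length (filter P? xs) ≡
        length (filter (λ x → P? x ×-dec Q? x) xs) + length (filter (λ x → P? x ×-dec ¬? (Q? x)) xs)
      length-filter-split Q? [] = refl
      length-filter-split Q? (x ∷ xs) with P? x | Q? x
      ... | yes _ | yes _ = cong suc (length-filter-split Q? xs)
      ... | yes _ | no _ = trans (cong suc (length-filter-split Q? xs)) (sym (ℕP.+-suc _ _))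
      ... | no _ | _ = length-filter-split Q? xs

    length-filter-≟ : ∀ (_≟_ : DecidableEquality A) {L v} → Unique L → v ∈ L → length (filter (v ≟_) L) ≡ 1
    length-filter-≟ _≟_ {y ∷ ys} (y∉ys ∷ _) (here refl) with y ≟ y
    ... | yes _ = cong suc (cong length (filter-none (y ≟_) y∉ys))
    ... | no y≢y = ⊥-elim (y≢y refl)
    length-filter-≟ _≟_ {y ∷ ys} {v} (y∉ys ∷ ys!) (there v∈ys) with v ≟ y
    ... | yes refl = ⊥-elim (All.lookup y∉ys v∈ys refl)
    ... | no _ = length-filter-≟ _≟_ ys! v∈ys

    filter-filter : ∀ {P Q : Pred A 0ℓ} (P? : Decidable P) (Q? : Decidable Q) xs →
      filter Q? (filter P? xs) ≡ filter (λ x → P? x ×-dec Q? x) xs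
    filter-filter P? Q? [] = refl
    filter-filter P? Q? (x ∷ xs) with P? x | Q? x
    ... | yes _ | yes Qx = trans (filter-accept Q? Qx) (cong (x ∷_) (filter-filter P? Q? xs))
    ... | yes _ | no ¬Qx = trans (filter-reject Q? ¬Qx) (filter-filter P? Q? xs)
    ... | no _ | _ = filter-filter P? Q? xs

  module _ {A : Set} {g : A → ℕ} {m : ℕ} where

    sum-map-const : ∀ L → (∀ {w} → w ∈ L → g w ≡ m) → sum (map g L) ≡ length L * m
    sum-map-const [] _ = refl
    sum-map-const (w ∷ L) g≡m = cong₂ _+_ (g≡m (here refl)) (sum-map-const L (g≡m ∘ there))

    sum-map-≤ : ∀ L → (∀ {w} → w ∈ L → g w ≤ m) → sum (map g L) ≤ length L * m
    sum-map-≤ [] _ = z≤n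
    sum-map-≤ (w ∷ L) g≤m = ℕP.+-mono-≤ (g≤m (here refl)) (sum-map-≤ L (g≤m ∘ there))

    sum-map-0-or : ∀ L → (∀ {w} → w ∈ L → g w ≡ 0 ⊎ g w ≡ m) →
      sum (map g L) ≡ length (filter (λ w → g w ℕ.≟ m) L) * m
    sum-map-0-or [] _ = refl
    sum-map-0-or (w ∷ L) g∈ = begin
      g w + sum (map g L)           ≡⟨ cong₂ _+_ (indicator (g w ℕ.≟ m) (g∈ (here refl))) (sum-map-0-or L (g∈ ∘ there)) ⟩
      𝟙 (g w ℕ.≟ m) * m + |L′| * m  ≡⟨ ℕP.*-distribʳ-+ m (𝟙 (g w ℕ.≟ m)) |L′| ⟨
      (𝟙 (g w ℕ.≟ m) + |L′|) * m    ≡⟨ cong (_* m) (length-filter-∷ (λ v → g v ℕ.≟ m) w L) ⟨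
      length (filter (λ v → g v ℕ.≟ m) (w ∷ L)) * m ∎
      where
      open ≡-Reasoning
      |L′| = length (filter (λ v → g v ℕ.≟ m) L)
      indicator : ∀ {k} (k≟m : Dec (k ≡ m)) → k ≡ 0 ⊎ k ≡ m → k ≡ 𝟙 k≟m * m
      indicator {k} (yes refl) _ = sym (ℕP.+-identityʳ k)
      indicator (no _) (inj₁ refl) = refl
      indicator (no k≢m) (inj₂ k≡m) = ⊥-elim (k≢m k≡m)

  module Enumeration {A : Set} (_≟_ : DecidableEquality A) {elems : List A}
                     (elems-unique : Unique elems) (elems-complete : ∀ x → x ∈ elems) where

    count : (P : Pred A 0ℓ) → Decidable P → ℕ
    count P P? = length (filter P? elems)

    module _ {P : Pred A 0ℓ} (P? : Decidable P) where

      count-cong : ∀ {Q : Pred A 0ℓ} (Q? : Decidable Q) → P ≐ Q → count P P? ≡ count Q Q?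
      count-cong Q? P≐Q = cong length (filter-≐ P? Q? P≐Q elems)

      count-all : (∀ x → P x) → count P P? ≡ length elems
      count-all all = cong length (filter-all P? (All.universal all elems))

      count≢0⇒∃ : count P P? ≢ 0 → ∃ P
      count≢0⇒∃ c≢0 with filter P? elems | all-filter P? elems
      ... | [] | _ = ⊥-elim (c≢0 refl)
      ... | x ∷ _ | Px ∷ _ = x , Px

      count-bijection : (h h⁻¹ : A → A) → (∀ x → h⁻¹ (h x) ≡ x) → (∀ y → h (h⁻¹ y) ≡ y) →
        count (P ∘ h) (P? ∘ h) ≡ count P P?
      count-bijection h h⁻¹ left right = begin
        length (filter (P? ∘ h) elems)   ≡⟨ length-filter≡sum-𝟙 (P? ∘ h) elems ⟩
        sum (map (𝟙 ∘ P? ∘ h) elems)     ≡⟨ foldr-reindex ℕP.+-0-isCommutativeMonoid (𝟙 ∘ P?) h-permutes ⟩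
        sum (map (𝟙 ∘ P?) elems)         ≡⟨ length-filter≡sum-𝟙 P? elems ⟨
        length (filter P? elems)         ∎
        where
        open ≡-Reasoning
        h-permutes : map h elems ↭ elems
        h-permutes = ↭-map-bijection elems-unique h h⁻¹ left right (λ _ → elems-complete _) (λ _ → elems-complete _)

    count-≢ : ∀ {P : Pred A 0ℓ} (P? : Decidable P) {v} → P v →
      count P P? ≡ suc (count (λ x → P x × x ≢ v) (λ x → P? x ×-dec ¬? (x ≟ v)))
    count-≢ {P} P? {v} Pv = begin
      count P P?                                                     ≡⟨ length-filter-split P? (_≟ v) elems ⟩
      count (λ x → P x × x ≡ v) (λ x → P? x ×-dec (x ≟ v)) + others  ≡⟨ cong (_+ others) (count-cong _ (v ≟_) (to , from)) ⟩
      count (v ≡_) (v ≟_) + others                                   ≡⟨ cong (_+ others) (length-filter-≟ _≟_ elems-unique (elems-complete v)) ⟩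
      suc others                                                     ∎
      where
      open ≡-Reasoning
      others = count (λ x → P x × x ≢ v) (λ x → P? x ×-dec ¬? (x ≟ v))
      to : ∀ {x} → P x × x ≡ v → v ≡ x
      to (_ , refl) = refl
      from : ∀ {x} → v ≡ x → P x × x ≡ v
      from refl = Pv , refl

    fibre : ∀ {R : Pred A 0ℓ} → Decidable R → (A → A) → A → ℕ
    fibre {R} R? π w = count (λ x → R x × π x ≡ w) (λ x → R? x ×-dec (π x ≟ w))

    module _ {R Q : Pred A 0ℓ} (R? : Decidable R) (Q? : Decidable Q) (π : A → A) (R⇒Q : ∀ {x} → R x → Q (π x)) where

      count-fibres : count R R? ≡ sum (map (fibre R? π) (filter Q? elems))
      count-fibres = go elems
        where
        open ≡-Reasoning
        L = filter Q? elems
        fibreIn : List A → A → ℕ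
        fibreIn xs w = length (filter (λ x → R? x ×-dec (π x ≟ w)) xs)
        hits : ∀ x → sum (map (λ w → 𝟙 (R? x ×-dec (π x ≟ w))) L) ≡ 𝟙 (R? x)
        hits x with R? x
        ... | no _ = trans (sum-map-const {g = const 0} L (λ _ → refl)) (ℕP.*-zeroʳ (length L))
        ... | yes Rx = begin
          sum (map (𝟙 ∘ (π x ≟_)) L)  ≡⟨ length-filter≡sum-𝟙 (π x ≟_) L ⟨
          length (filter (π x ≟_) L)  ≡⟨ length-filter-≟ _≟_ (Unique.filter⁺ Q? elems-unique) πx∈L ⟩
          1                           ∎
          where
          πx∈L : π x ∈ L
          πx∈L = ∈-filter⁺ Q? (elems-complete (π x)) (R⇒Q Rx)
        go : ∀ xs → length (filter R? xs) ≡ sum (map (fibreIn xs) L)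
        go [] = sym (trans (sum-map-const {g = const 0} L (λ _ → refl)) (ℕP.*-zeroʳ (length L)))
        go (x ∷ xs) = begin
          length (filter R? (x ∷ xs))                                  ≡⟨ length-filter-∷ R? x xs ⟩
          𝟙 (R? x) + length (filter R? xs)                             ≡⟨ cong₂ _+_ (sym (hits x)) (go xs) ⟩
          sum (map (λ w → 𝟙 (R? x ×-dec (π x ≟ w))) L) + sum (map (fibreIn xs) L)
            ≡⟨ foldr-map-∙ ℕP.+-0-isCommutativeMonoid _ _ L ⟨
          sum (map (λ w → 𝟙 (R? x ×-dec (π x ≟ w)) + fibreIn xs w) L) ≡⟨ cong sum (map-cong (λ w → sym (length-filter-∷ _ x xs)) L) ⟩
          sum (map (fibreIn (x ∷ xs)) L)                               ∎

      private
        ∈L⇒Q : ∀ {w} → w ∈ filter Q? elems → Q w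
        ∈L⇒Q w∈ = proj₂ (∈-filter⁻ Q? {xs = elems} w∈)

      count-fibres-const : ∀ {m} → (∀ {w} → Q w → fibre R? π w ≡ m) → count R R? ≡ count Q Q? * m
      count-fibres-const hyp = trans count-fibres (sum-map-const _ (hyp ∘ ∈L⇒Q))

      count-fibres-≤ : ∀ {m} → (∀ {w} → Q w → fibre R? π w ≤ m) → count R R? ≤ count Q Q? * m
      count-fibres-≤ hyp = ℕP.≤-trans (ℕP.≤-reflexive count-fibres) (sum-map-≤ _ (hyp ∘ ∈L⇒Q))

      count-fibres-0-or : ∀ {m} → (∀ {w} → Q w → fibre R? π w ≡ 0 ⊎ fibre R? π w ≡ m) →
        count R R? ≡ count (λ w → Q w × fibre R? π w ≡ m) (λ w → Q? w ×-dec (fibre R? π w ℕ.≟ m)) * m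
      count-fibres-0-or {m} hyp = begin
        count R R?                                                        ≡⟨ count-fibres ⟩
        sum (map (fibre R? π) (filter Q? elems))                          ≡⟨ sum-map-0-or _ (hyp ∘ ∈L⇒Q) ⟩
        length (filter (λ w → fibre R? π w ℕ.≟ m) (filter Q? elems)) * m ≡⟨ cong (λ L → length L * m) (filter-filter Q? _ elems) ⟩
        count (λ w → Q w × fibre R? π w ≡ m) (λ w → Q? w ×-dec (fibre R? π w ℕ.≟ m)) * m ∎
        where open ≡-Reasoning

-- Algebra.Solver.Ring with coefficients in ℤ, mapped into the ring by the canonical homomorphism: the
-- normaliser must decide equality of coefficients, which it cannot do for elements of an abstract ring.
module IntegerCoefficientRingSolver {A : Set} {add mul : A → A → A} {neg : A → A} {0a 1a : A}
  (isCommutativeRing : Algebra.Structures.IsCommutativeRing _≡_ add mul neg 0a 1a) where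
  open import Level using (0ℓ)
  open import Data.Nat as ℕ using (ℕ; zero; suc)
  import Data.Nat.Properties as ℕP
  open import Data.Integer as ℤ using (ℤ; -[1+_]; _⊖_; _◃_; sign; ∣_∣)
  import Data.Integer.Properties as ℤP
  open import Data.Sign as Sign using (Sign)
  open import Data.Maybe using (Maybe; just; nothing)
  open import Relation.Nullary using (yes; no)
  open import Relation.Binary.PropositionalEquality
  open import Algebra.Bundles using (CommutativeRing)
  open import Algebra.Solver.Ring.AlmostCommutativeRing using (fromCommutativeRing; _-Raw-AlmostCommutative⟶_)

  private
    commutativeRing : CommutativeRing 0ℓ 0ℓ
    commutativeRing = record { isCommutativeRing = isCommutativeRing }
    open CommutativeRing commutativeRing
      using (_+_; _*_; -_; 0#; 1#; +-comm; +-identityˡ; +-identityʳ; -‿inverseʳ; ring; semiring; +-abelianGroup; +-commutativeSemigroup)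
    open import Algebra.Properties.Ring ring using (-‿involutive; -0#≈0#; -‿distribˡ-*; -‿distribʳ-*)
    open import Algebra.Properties.AbelianGroup +-abelianGroup using (⁻¹-∙-comm)
    open import Algebra.Properties.CommutativeSemigroup +-commutativeSemigroup using (interchange)
    open import Algebra.Properties.Semiring.Mult semiring using (_×_; ×-homo-+; ×1-homo-*)

    ⟦_⟧ : ℤ → A
    ⟦ ℤ.+ n ⟧ = n × 1#
    ⟦ -[1+ n ] ⟧ = - (suc n × 1#)

    ⊖-homo : ∀ m n → ⟦ m ⊖ n ⟧ ≡ m × 1# + - (n × 1#)
    ⊖-homo m zero = sym (trans (cong ((m × 1#) +_) -0#≈0#) (+-identityʳ _))
    ⊖-homo zero (suc n) = sym (+-identityˡ _)
    ⊖-homo (suc m) (suc n) = begin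
      ⟦ suc m ⊖ suc n ⟧                      ≡⟨ cong ⟦_⟧ (ℤP.[1+m]⊖[1+n]≡m⊖n m n) ⟩
      ⟦ m ⊖ n ⟧                              ≡⟨ ⊖-homo m n ⟩
      a + - b                                ≡⟨ +-identityˡ _ ⟨
      0# + (a + - b)                         ≡⟨ cong (_+ (a + - b)) (-‿inverseʳ 1#) ⟨
      (1# + - 1#) + (a + - b)                ≡⟨ interchange 1# (- 1#) a (- b) ⟩
      (1# + a) + (- 1# + - b)                ≡⟨ cong ((1# + a) +_) (⁻¹-∙-comm 1# b) ⟩
      (1# + a) + - (1# + b)                  ∎
      where
      open ≡-Reasoning
      a = m × 1#
      b = n × 1#

    +-homo : ∀ i j → ⟦ i ℤ.+ j ⟧ ≡ ⟦ i ⟧ + ⟦ j ⟧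
    +-homo (ℤ.+ m) (ℤ.+ n) = ×-homo-+ 1# m n
    +-homo (ℤ.+ m) -[1+ n ] = ⊖-homo m (suc n)
    +-homo -[1+ m ] (ℤ.+ n) = trans (⊖-homo n (suc m)) (+-comm _ _)
    +-homo -[1+ m ] -[1+ n ] = trans (cong -_ suc-homo) (sym (⁻¹-∙-comm _ _))
      where
      suc-homo : suc (suc (m ℕ.+ n)) × 1# ≡ suc m × 1# + suc n × 1#
      suc-homo = trans (cong (λ k → suc k × 1#) (sym (ℕP.+-suc m n))) (×-homo-+ 1# (suc m) (suc n))

    signed : Sign → A → A
    signed Sign.+ x = x
    signed Sign.- x = - x

    ⟦⟧≡signed : ∀ i → ⟦ i ⟧ ≡ signed (sign i) (∣ i ∣ × 1#)
    ⟦⟧≡signed (ℤ.+ n) = refl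
    ⟦⟧≡signed -[1+ n ] = refl

    ◃-homo : ∀ s n → ⟦ s ◃ n ⟧ ≡ signed s (n × 1#)
    ◃-homo Sign.+ zero = refl
    ◃-homo Sign.- zero = sym -0#≈0#
    ◃-homo Sign.+ (suc n) = refl
    ◃-homo Sign.- (suc n) = refl

    signed-* : ∀ s t x y → signed (s Sign.* t) (x * y) ≡ signed s x * signed t y
    signed-* Sign.+ Sign.+ x y = refl
    signed-* Sign.+ Sign.- x y = -‿distribʳ-* x y
    signed-* Sign.- Sign.+ x y = -‿distribˡ-* x y
    signed-* Sign.- Sign.- x y = begin
      x * y           ≡⟨ -‿involutive (x * y) ⟨
      - - (x * y)     ≡⟨ cong -_ (-‿distribˡ-* x y) ⟩
      - (- x * y)     ≡⟨ -‿distribʳ-* (- x) y ⟩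
      - x * - y       ∎
      where open ≡-Reasoning

    *-homo : ∀ i j → ⟦ i ℤ.* j ⟧ ≡ ⟦ i ⟧ * ⟦ j ⟧
    *-homo i j = begin
      ⟦ s ◃ (∣ i ∣ ℕ.* ∣ j ∣) ⟧                                 ≡⟨ ◃-homo s (∣ i ∣ ℕ.* ∣ j ∣) ⟩
      signed s ((∣ i ∣ ℕ.* ∣ j ∣) × 1#)                         ≡⟨ cong (signed s) (×1-homo-* ∣ i ∣ ∣ j ∣) ⟩
      signed s ((∣ i ∣ × 1#) * (∣ j ∣ × 1#))                    ≡⟨ signed-* (sign i) (sign j) _ _ ⟩
      signed (sign i) (∣ i ∣ × 1#) * signed (sign j) (∣ j ∣ × 1#) ≡⟨ cong₂ _*_ (⟦⟧≡signed i) (⟦⟧≡signed j) ⟨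
      ⟦ i ⟧ * ⟦ j ⟧                                             ∎
      where
      open ≡-Reasoning
      s = sign i Sign.* sign j

    -‿homo : ∀ i → ⟦ ℤ.- i ⟧ ≡ - ⟦ i ⟧
    -‿homo (ℤ.+ zero) = sym -0#≈0#
    -‿homo (ℤ.+ suc n) = refl
    -‿homo -[1+ n ] = sym (-‿involutive _)

    homomorphism : ℤ.+-*-rawRing -Raw-AlmostCommutative⟶ fromCommutativeRing commutativeRing
    homomorphism = record
      { ⟦_⟧ = ⟦_⟧ ; +-homo = +-homo ; *-homo = *-homo ; -‿homo = -‿homo
      ; 0-homo = refl ; 1-homo = +-identityʳ 1# }

    _coeff≟_ : ∀ i j → Maybe (⟦ i ⟧ ≡ ⟦ j ⟧)
    i coeff≟ j with i ℤ.≟ j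
    ... | yes i≡j = just (cong ⟦_⟧ i≡j)
    ... | no _ = nothing

  open import Algebra.Solver.Ring ℤ.+-*-rawRing (fromCommutativeRing commutativeRing) homomorphism _coeff≟_ public
    using (solve; _:+_; _:*_; :-_; _:-_; _:=_)

module FieldTheory (K : FiniteField) where
  open import Level using (0ℓ)
  open import Data.Nat as ℕ using (ℕ; zero; suc; _∸_; _≤_; _<_; z≤n; s≤s; NonZero)
  import Data.Nat.Properties as ℕP
  open import Data.List using (List; []; _∷_; length; map; foldr; filter; replicate)
  open import Data.List.Properties using (length-replicate)
  open import Data.List.Membership.Propositional using (_∈_)
  open import Data.List.Membership.Propositional.Properties using (∈-filter⁺; ∈-filter⁻)
  open import Data.List.Relation.Unary.All as All using (All; []; _∷_)
  open import Data.List.Relation.Unary.All.Properties using (all-filter)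
  open import Data.List.Relation.Unary.AllPairs using ([]; _∷_)
  open import Data.List.Relation.Unary.Unique.Propositional using (Unique)
  open import Data.List.Relation.Binary.Permutation.Propositional using (_↭_)
  import Data.List.Relation.Unary.Unique.Propositional.Properties as Unique
  open import Data.Product using (_×_; _,_; proj₁; proj₂; ∃)
  open import Data.Sum using (_⊎_; inj₁; inj₂)
  open import Data.Empty using (⊥-elim)
  open import Data.Unit using (⊤; tt)
  open import Function using (_∘_; id)
  open import Relation.Nullary using (yes; no)
  open import Relation.Unary using (Decidable)
  open import Relation.Nullary.Decidable using (¬?; _×-dec_)
  open import Relation.Binary.PropositionalEquality
  open import Algebra.Bundles using (CommutativeRing)
  import Relation.Binary.Construct.Closure.Equivalence as EqClosure
  open import Relation.Binary.Construct.Closure.Symmetric using (fwd)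
  open import Relation.Binary.Construct.Closure.ReflexiveTransitive using (ε; _◅_)
  open import Data.Fin as Fin using (Fin)
  open import Data.Fin.Properties using (toℕ-fromℕ; toℕ-inject₁; toℕ<n)
  open import Data.Nat.Combinatorics using (_C_; nCn≡1)
  open import Data.Nat.Divisibility using (_∣_; divides)
  open import Data.Nat.Primality using (Prime; prime⇒nonZero)
  open NatLemmas using (prime∣pCk)

  open FF K public
  open Counting using (↭-map-bijection; foldr-reindex; foldr-map-∙)
  -- The count of this enumeration unfolds to FF.count, so the lemmas below apply to FF.count.
  open Counting.Enumeration _≟_ elems-unique elems-complete public hiding (count)
  open IntegerCoefficientRingSolver isCommRing public

  commutativeRing : CommutativeRing 0ℓ 0ℓ
  commutativeRing = record { isCommutativeRing = isCommRing }

  open CommutativeRing commutativeRing public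
    using (+-comm; +-identityˡ; +-identityʳ; *-assoc; *-comm; *-identityˡ; *-identityʳ;
           distribʳ; zeroˡ; zeroʳ; -‿inverseˡ; -‿inverseʳ;
           +-isCommutativeMonoid; *-isCommutativeMonoid; ring; semiring; commutativeSemiring; +-group)
  open import Algebra.Properties.Ring ring public using (-‿involutive; -0#≈0#; -‿distribˡ-*)
  open import Algebra.Properties.Group +-group public
    using (identityˡ-unique; identityʳ-unique; inverseˡ-unique; inverseʳ-unique; x∙y⁻¹≈ε⇒x≈y; x≈y⇒x∙y⁻¹≈ε)
  open import Algebra.Properties.Semiring.Mult semiring public using (×1-homo-*; ×-assoc-*) renaming (_×_ to _·_)
  open import Algebra.Properties.CommutativeSemiring.Exp commutativeSemiring using (_^_; ^-homo-*; ^-assocʳ; ^-distrib-*)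
  open import Algebra.Properties.CommutativeSemiring.Binomial commutativeSemiring using (theorem; binomialExpansion; binomialTerm)
  open import Algebra.Properties.Monoid.Sum (CommutativeRing.+-monoid commutativeRing)
    using (sum; sum-init-last; sum-cong-≗; sum-replicate-zero)

  ^ᶠ≡^ : ∀ x n → x ^ᶠ n ≡ x ^ n
  ^ᶠ≡^ x zero = refl
  ^ᶠ≡^ x (suc n) = cong (x *_) (^ᶠ≡^ x n)

  ^ᶠ-homo-* : ∀ x m n → x ^ᶠ (m ℕ.+ n) ≡ x ^ᶠ m * x ^ᶠ n
  ^ᶠ-homo-* x m n rewrite ^ᶠ≡^ x (m ℕ.+ n) | ^ᶠ≡^ x m | ^ᶠ≡^ x n = ^-homo-* x m n

  ^ᶠ-assocʳ : ∀ x m n → (x ^ᶠ m) ^ᶠ n ≡ x ^ᶠ (m ℕ.* n)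
  ^ᶠ-assocʳ x m n rewrite ^ᶠ≡^ (x ^ᶠ m) n | ^ᶠ≡^ x m | ^ᶠ≡^ x (m ℕ.* n) = ^-assocʳ x m n

  ^ᶠ-distrib-* : ∀ x y n → (x * y) ^ᶠ n ≡ x ^ᶠ n * y ^ᶠ n
  ^ᶠ-distrib-* x y n rewrite ^ᶠ≡^ (x * y) n | ^ᶠ≡^ x n | ^ᶠ≡^ y n = ^-distrib-* x y n

  1^ᶠ : ∀ n → 1# ^ᶠ n ≡ 1#
  1^ᶠ zero = refl
  1^ᶠ (suc n) = trans (*-identityˡ _) (1^ᶠ n)

  0^ᶠ : ∀ {n} → 0 < n → 0# ^ᶠ n ≡ 0#
  0^ᶠ (s≤s _) = zeroˡ _

  x-y≡0⇒x≡y : ∀ {x y} → x - y ≡ 0# → x ≡ y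
  x-y≡0⇒x≡y = x∙y⁻¹≈ε⇒x≈y _ _

  x+y≡0⇒y≡-x : ∀ {x y} → x + y ≡ 0# → y ≡ - x
  x+y≡0⇒y≡-x = inverseʳ-unique _ _

  -x≡0⇒x≡0 : ∀ {x} → - x ≡ 0# → x ≡ 0#
  -x≡0⇒x≡0 {x} -x≡0 = trans (sym (-‿involutive x)) (trans (cong -_ -x≡0) -0#≈0#)

  1≢0 : 1# ≢ 0#
  1≢0 = 0≢1 ∘ sym

  _⁻¹⟨_⟩ : ∀ x → x ≢ 0# → Carrier
  x ⁻¹⟨ x≢0 ⟩ = proj₁ (inverse x x≢0)

  x*x⁻¹≡1 : ∀ x (x≢0 : x ≢ 0#) → x * x ⁻¹⟨ x≢0 ⟩ ≡ 1#
  x*x⁻¹≡1 x x≢0 = proj₂ (inverse x x≢0)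

  x⁻¹*x*y≡y : ∀ x (x≢0 : x ≢ 0#) y → x ⁻¹⟨ x≢0 ⟩ * (x * y) ≡ y
  x⁻¹*x*y≡y x x≢0 y = begin
    x ⁻¹⟨ x≢0 ⟩ * (x * y) ≡⟨ *-assoc _ _ _ ⟨
    (x ⁻¹⟨ x≢0 ⟩ * x) * y ≡⟨ cong (_* y) (trans (*-comm _ _) (x*x⁻¹≡1 x x≢0)) ⟩
    1# * y                ≡⟨ *-identityˡ y ⟩
    y                     ∎
    where open ≡-Reasoning

  x*x⁻¹*y≡y : ∀ x (x≢0 : x ≢ 0#) y → x * (x ⁻¹⟨ x≢0 ⟩ * y) ≡ y
  x*x⁻¹*y≡y x x≢0 y = trans (sym (*-assoc _ _ _)) (trans (cong (_* y) (x*x⁻¹≡1 x x≢0)) (*-identityˡ y))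

  *-cancelˡ : ∀ {x y z} → x ≢ 0# → x * y ≡ x * z → y ≡ z
  *-cancelˡ {x} {y} {z} x≢0 xy≡xz = begin
    y                     ≡⟨ x⁻¹*x*y≡y x x≢0 y ⟨
    x ⁻¹⟨ x≢0 ⟩ * (x * y) ≡⟨ cong (x ⁻¹⟨ x≢0 ⟩ *_) xy≡xz ⟩
    x ⁻¹⟨ x≢0 ⟩ * (x * z) ≡⟨ x⁻¹*x*y≡y x x≢0 z ⟩
    z                     ∎
    where open ≡-Reasoning

  x*y≡0⇒x≡0∨y≡0 : ∀ x {y} → x * y ≡ 0# → x ≡ 0# ⊎ y ≡ 0#
  x*y≡0⇒x≡0∨y≡0 x {y} xy≡0 with x ≟ 0#
  ... | yes x≡0 = inj₁ x≡0
  ... | no x≢0 = inj₂ (*-cancelˡ x≢0 (trans xy≡0 (sym (zeroʳ x))))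

  *-nonzero : ∀ {x y} → x ≢ 0# → y ≢ 0# → x * y ≢ 0#
  *-nonzero {x} x≢0 y≢0 xy≡0 with x*y≡0⇒x≡0∨y≡0 x xy≡0
  ... | inj₁ x≡0 = x≢0 x≡0
  ... | inj₂ y≡0 = y≢0 y≡0

  ^ᶠ-nonzero : ∀ {x} n → x ≢ 0# → x ^ᶠ n ≢ 0#
  ^ᶠ-nonzero zero x≢0 = 1≢0
  ^ᶠ-nonzero (suc n) x≢0 = *-nonzero x≢0 (^ᶠ-nonzero n x≢0)

  x^n≡0⇒x≡0 : ∀ {x} n → x ^ᶠ n ≡ 0# → x ≡ 0#
  x^n≡0⇒x≡0 {x} n xⁿ≡0 with x ≟ 0#
  ... | yes x≡0 = x≡0
  ... | no x≢0 = ⊥-elim (^ᶠ-nonzero n x≢0 xⁿ≡0)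

  x⁻¹≢0 : ∀ x (x≢0 : x ≢ 0#) → x ⁻¹⟨ x≢0 ⟩ ≢ 0#
  x⁻¹≢0 x x≢0 x⁻¹≡0 = 1≢0 (trans (sym (x*x⁻¹≡1 x x≢0)) (trans (cong (x *_) x⁻¹≡0) (zeroʳ x)))

  *-cancelʳ : ∀ {x y z} → x ≢ 0# → y * x ≡ z * x → y ≡ z
  *-cancelʳ {x} {y} {z} x≢0 yx≡zx = *-cancelˡ x≢0 (trans (*-comm x y) (trans yx≡zx (*-comm z x)))

  x*x≡y*y⇒x≡±y : ∀ {x y} → x * x ≡ y * y → x ≡ y ⊎ x ≡ - y
  x*x≡y*y⇒x≡±y {x} {y} x²≡y² with x*y≡0⇒x≡0∨y≡0 (x - y) difference-of-squares
    where
    difference-of-squares : (x - y) * (x + y) ≡ 0#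
    difference-of-squares = begin
      (x - y) * (x + y)  ≡⟨ solve 2 (λ x y → (x :- y) :* (x :+ y) := x :* x :- y :* y) refl x y ⟩
      x * x - y * y      ≡⟨ x≈y⇒x∙y⁻¹≈ε x²≡y² ⟩
      0#                 ∎
      where open ≡-Reasoning
  ... | inj₁ x-y≡0 = inj₁ (x-y≡0⇒x≡y x-y≡0)
  ... | inj₂ x+y≡0 = inj₂ (inverseˡ-unique x y x+y≡0)

  -- Finite fields: characteristic and Fermat's little theorem

  Σ-const : ∀ c (L : List Carrier) → foldr _+_ 0# (map (λ _ → c) L) ≡ length L · c
  Σ-const c [] = refl
  Σ-const c (_ ∷ L) = cong (c +_) (Σ-const c L)

  Π-const : ∀ c (L : List Carrier) → foldr _*_ 1# (map (λ _ → c) L) ≡ c ^ᶠ length L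
  Π-const c [] = refl
  Π-const c (_ ∷ L) = cong (c *_) (Π-const c L)

  Π-nonzero : ∀ {L} → All (_≢ 0#) L → foldr _*_ 1# (map id L) ≢ 0#
  Π-nonzero [] = 1≢0
  Π-nonzero (y≢0 ∷ L≢0) = *-nonzero y≢0 (Π-nonzero L≢0)

  card·1≡0 : card · 1# ≡ 0#
  card·1≡0 = identityʳ-unique Σx (card · 1#) (begin
    Σx + card · 1#                            ≡⟨ cong (Σx +_) (Σ-const 1# elems) ⟨
    Σx + foldr _+_ 0# (map (λ _ → 1#) elems)  ≡⟨ foldr-map-∙ +-isCommutativeMonoid id (λ _ → 1#) elems ⟨
    foldr _+_ 0# (map (_+ 1#) elems)          ≡⟨ foldr-reindex +-isCommutativeMonoid id +1-permutes ⟩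
    Σx                                        ∎)
    where
    open ≡-Reasoning
    Σx = foldr _+_ 0# (map id elems)
    +1-permutes : map (_+ 1#) elems ↭ elems
    +1-permutes = ↭-map-bijection elems-unique (_+ 1#) (_- 1#)
      (λ x → solve 2 (λ x u → (x :+ u) :- u := x) refl x 1#) (λ x → solve 2 (λ x u → (x :- u) :+ u := x) refl x 1#)
      (λ _ → elems-complete _) (λ _ → elems-complete _)

  m·x≡m·1*x : ∀ m x → m · x ≡ (m · 1#) * x
  m·x≡m·1*x m x = sym (trans (×-assoc-* m 1# x) (cong (m ·_) (*-identityˡ x)))

  m^n·1≡[m·1]^n : ∀ m n → (m ℕ.^ n) · 1# ≡ (m · 1#) ^ᶠ n
  m^n·1≡[m·1]^n m zero = +-identityʳ 1#
  m^n·1≡[m·1]^n m (suc n) = trans (×1-homo-* m (m ℕ.^ n)) (cong ((m · 1#) *_) (m^n·1≡[m·1]^n m n))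

  card≡pᵉ⇒p·1≡0 : ∀ {p e} → card ≡ p ℕ.^ e → p · 1# ≡ 0#
  card≡pᵉ⇒p·1≡0 {p} {e} card≡pᵉ = x^n≡0⇒x≡0 e (begin
    (p · 1#) ^ᶠ e     ≡⟨ m^n·1≡[m·1]^n p e ⟨
    (p ℕ.^ e) · 1#    ≡⟨ cong (_· 1#) card≡pᵉ ⟨
    card · 1#         ≡⟨ card·1≡0 ⟩
    0#                ∎)
    where open ≡-Reasoning

  odd-characteristic⇒2≢0 : ∀ m → suc (m ℕ.* 2) · 1# ≡ 0# → 1# + 1# ≢ 0#
  odd-characteristic⇒2≢0 m char≡0 2≡0 = 1≢0 (begin
    1#                        ≡⟨ +-identityʳ 1# ⟨
    1# + 0#                   ≡⟨ cong (1# +_) (zeroʳ (m · 1#)) ⟨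
    1# + (m · 1#) * 0#        ≡⟨ cong (λ z → 1# + (m · 1#) * z) 2·1≡0 ⟨
    1# + (m · 1#) * (2 · 1#)  ≡⟨ cong (1# +_) (×1-homo-* m 2) ⟨
    suc (m ℕ.* 2) · 1#        ≡⟨ char≡0 ⟩
    0#                        ∎)
    where
    open ≡-Reasoning
    2·1≡0 : 2 · 1# ≡ 0#
    2·1≡0 = trans (cong (1# +_) (+-identityʳ 1#)) 2≡0

  nonzero? : Decidable (_≢ 0#)
  nonzero? x = ¬? (x ≟ 0#)

  K* : List Carrier
  K* = filter nonzero? elems

  card≡1+|K*| : card ≡ suc (length K*)
  card≡1+|K*| = begin
    card                                                   ≡⟨ count-all (λ _ → yes tt) (λ _ → tt) ⟨
    count (λ _ → ⊤) (λ _ → yes tt)                         ≡⟨ count-≢ (λ _ → yes tt) tt ⟩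
    suc (count (λ x → ⊤ × x ≢ 0#) (λ x → yes tt ×-dec nonzero? x)) ≡⟨ cong suc (count-cong _ nonzero? (proj₂ , (tt ,_))) ⟩
    suc (length K*)                                        ∎
    where open ≡-Reasoning

  ∈K*-preserved : ∀ {h : Carrier → Carrier} → (∀ {y} → y ≢ 0# → h y ≢ 0#) → ∀ {y} → y ∈ K* → h y ∈ K*
  ∈K*-preserved h≢0 y∈K* = ∈-filter⁺ nonzero? (elems-complete _) (h≢0 (proj₂ (∈-filter⁻ nonzero? {xs = elems} y∈K*)))

  x^card≡x : ∀ x → x ^ᶠ card ≡ x
  x^card≡x x with x ≟ 0#
  ... | yes refl = 0^ᶠ (subst (0 <_) (sym card≡1+|K*|) (s≤s z≤n))
  ... | no x≢0 = begin
    x ^ᶠ card             ≡⟨ cong (x ^ᶠ_) card≡1+|K*| ⟩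
    x * x ^ᶠ length K*    ≡⟨ cong (x *_) (*-cancelʳ (Π-nonzero (all-filter nonzero? elems)) x^|K*|*ΠK*≡1*ΠK*) ⟩
    x * 1#                ≡⟨ *-identityʳ x ⟩
    x                     ∎
    where
    open ≡-Reasoning
    ΠK* = foldr _*_ 1# (map id K*)
    x*-permutes : map (x *_) K* ↭ K*
    x*-permutes = ↭-map-bijection (Unique.filter⁺ nonzero? elems-unique) (x *_) (x ⁻¹⟨ x≢0 ⟩ *_)
      (x⁻¹*x*y≡y x x≢0) (x*x⁻¹*y≡y x x≢0) (∈K*-preserved (*-nonzero x≢0)) (∈K*-preserved (*-nonzero (x⁻¹≢0 x x≢0)))
    x^|K*|*ΠK*≡1*ΠK* : x ^ᶠ length K* * ΠK* ≡ 1# * ΠK*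
    x^|K*|*ΠK*≡1*ΠK* = begin
      x ^ᶠ length K* * ΠK*                    ≡⟨ cong (_* ΠK*) (Π-const x K*) ⟨
      foldr _*_ 1# (map (λ _ → x) K*) * ΠK*   ≡⟨ foldr-map-∙ *-isCommutativeMonoid (λ _ → x) id K* ⟨
      foldr _*_ 1# (map (x *_) K*)            ≡⟨ foldr-reindex *-isCommutativeMonoid id x*-permutes ⟩
      ΠK*                                     ≡⟨ *-identityˡ ΠK* ⟨
      1# * ΠK*                                ∎

  -- Polynomials and roots

  -- monic (c₀ ∷ … ∷ c_{d-1}) is the monic polynomial c₀ + c₁ X + … + c_{d-1} X^{d-1} + X^d.
  monic : List Carrier → Carrier → Carrier
  monic [] x = 1#
  monic (c ∷ cs) x = c + x * monic cs x

  monic-divide : ∀ c cs r →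
    ∃ λ ds → length ds ≡ length cs × (∀ x → monic (c ∷ cs) x ≡ (x - r) * monic ds x + monic (c ∷ cs) r)
  monic-divide c [] r = [] , refl , λ x →
    solve 4 (λ c x r u → c :+ x :* u := (x :- r) :* u :+ (c :+ r :* u)) refl c x r 1#
  monic-divide c (c′ ∷ cs) r with monic-divide c′ cs r
  ... | ds , |ds|≡|cs| , division = (monic (c′ ∷ cs) r ∷ ds) , cong suc |ds|≡|cs| , λ x → begin
    c + x * monic (c′ ∷ cs) x                          ≡⟨ cong (λ m → c + x * m) (division x) ⟩
    c + x * ((x - r) * monic ds x + m[r])
      ≡⟨ solve 5 (λ c x r d m → c :+ x :* ((x :- r) :* d :+ m) := (x :- r) :* (m :+ x :* d) :+ (c :+ r :* m)) refl c x r (monic ds x) m[r] ⟩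
    (x - r) * (m[r] + x * monic ds x) + (c + r * m[r])  ∎
    where
    open ≡-Reasoning
    m[r] = monic (c′ ∷ cs) r

  monic-roots : ∀ cs {L} → Unique L → All (λ t → monic cs t ≡ 0#) L → length L ≤ length cs
  monic-roots cs [] [] = z≤n
  monic-roots [] (_ ∷ _) (1≡0 ∷ _) = ⊥-elim (1≢0 1≡0)
  monic-roots (c ∷ cs) {r ∷ L} (r∉L ∷ L!) (r-root ∷ L-roots) with monic-divide c cs r
  ... | ds , |ds|≡|cs| , division =
    s≤s (subst (length L ≤_) |ds|≡|cs| (monic-roots ds L! (All.zipWith root-of-quotient (r∉L , L-roots))))
    where
    factor : ∀ t → monic (c ∷ cs) t ≡ (t - r) * monic ds t
    factor t = trans (division t) (trans (cong ((t - r) * monic ds t +_) r-root) (+-identityʳ _))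
    root-of-quotient : ∀ {t} → r ≢ t × monic (c ∷ cs) t ≡ 0# → monic ds t ≡ 0#
    root-of-quotient {t} (r≢t , t-root) with x*y≡0⇒x≡0∨y≡0 (t - r) (trans (sym (factor t)) t-root)
    ... | inj₁ t-r≡0 = ⊥-elim (r≢t (sym (x-y≡0⇒x≡y t-r≡0)))
    ... | inj₂ q-root = q-root

  roots-of-unity-bound : ∀ {d} L → 0 < d → Unique L → All (λ t → t ^ᶠ d ≡ 1#) L → length L ≤ d
  roots-of-unity-bound {suc d} L _ L! L-roots = subst (length L ≤_) (cong suc (length-replicate d))
    (monic-roots (- 1# ∷ replicate d 0#) L! (All.map root L-roots))
    where
    monic-0s : ∀ m x → monic (replicate m 0#) x ≡ x ^ᶠ m
    monic-0s zero x = refl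
    monic-0s (suc m) x = trans (+-identityˡ _) (cong (x *_) (monic-0s m x))
    root : ∀ {t} → t ^ᶠ suc d ≡ 1# → monic (- 1# ∷ replicate d 0#) t ≡ 0#
    root {t} t^d≡1 = trans (cong (λ m → - 1# + t * m) (monic-0s d t)) (trans (cong (- 1# +_) t^d≡1) (-‿inverseˡ 1#))

  -- The binomial theorem in characteristic p

  sum-first-last : ∀ n (t : Fin (suc (suc n)) → Carrier) → (∀ (i : Fin n) → t (Fin.suc (Fin.inject₁ i)) ≡ 0#) →
    sum t ≡ t Fin.zero + t (Fin.fromℕ (suc n))
  sum-first-last n t inner≡0 = cong (t Fin.zero +_) (begin
    sum (t ∘ Fin.suc)                                             ≡⟨ sum-init-last (t ∘ Fin.suc) ⟩
    sum (t ∘ Fin.suc ∘ Fin.inject₁) + t (Fin.fromℕ (suc n))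
      ≡⟨ cong (_+ t (Fin.fromℕ (suc n))) (trans (sum-cong-≗ inner≡0) (sum-replicate-zero n)) ⟩
    0# + t (Fin.fromℕ (suc n))                                     ≡⟨ +-identityˡ _ ⟩
    t (Fin.fromℕ (suc n))                                          ∎)
    where open ≡-Reasoning

  binomial-inner-vanish : ∀ n x y → (∀ {k} → 0 < k → k < suc n → ∀ z → (suc n C k) · z ≡ 0#) →
    (x + y) ^ᶠ suc n ≡ x ^ᶠ suc n + y ^ᶠ suc n
  binomial-inner-vanish n x y inner≡0 = begin
    (x + y) ^ᶠ suc n                              ≡⟨ ^ᶠ≡^ (x + y) (suc n) ⟩
    (x + y) ^ suc n                               ≡⟨ theorem (suc n) x y ⟩
    binomialExpansion x y (suc n)                 ≡⟨ sum-first-last n term inner ⟩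
    term Fin.zero + term (Fin.fromℕ (suc n))      ≡⟨ cong₂ _+_ first last ⟩
    y ^ᶠ suc n + x ^ᶠ suc n                       ≡⟨ +-comm _ _ ⟩
    x ^ᶠ suc n + y ^ᶠ suc n                       ∎
    where
    open ≡-Reasoning
    term = binomialTerm x y (suc n)
    inner : ∀ (i : Fin n) → term (Fin.suc (Fin.inject₁ i)) ≡ 0#
    inner i = inner≡0 (s≤s z≤n) (s≤s (subst (ℕ._< n) (sym (toℕ-inject₁ i)) (toℕ<n i))) _
    first : term Fin.zero ≡ y ^ᶠ suc n
    first = trans (+-identityʳ _) (trans (*-identityˡ _) (sym (^ᶠ≡^ y (suc n))))
    last : term (Fin.fromℕ (suc n)) ≡ x ^ᶠ suc n
    last = begin
      term (Fin.fromℕ (suc n))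
        ≡⟨ cong (λ k → (suc n C k) · (x ^ k * y ^ (suc n ∸ k))) (toℕ-fromℕ (suc n)) ⟩
      (suc n C suc n) · (x ^ suc n * y ^ (suc n ∸ suc n))
        ≡⟨ cong₂ (λ c e → c · (x ^ suc n * y ^ e)) (nCn≡1 (suc n)) (ℕP.n∸n≡0 n) ⟩
      1 · (x ^ suc n * 1#)                                      ≡⟨ trans (+-identityʳ _) (*-identityʳ _) ⟩
      x ^ suc n                                                 ≡⟨ ^ᶠ≡^ x (suc n) ⟨
      x ^ᶠ suc n                                                ∎

  module Characteristic {p} (p-prime : Prime p) (p·1≡0 : p · 1# ≡ 0#) where

    p∣m⇒m·x≡0 : ∀ {m} x → p ∣ m → m · x ≡ 0#
    p∣m⇒m·x≡0 x (divides c refl) = begin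
      (c ℕ.* p) · x               ≡⟨ m·x≡m·1*x (c ℕ.* p) x ⟩
      ((c ℕ.* p) · 1#) * x        ≡⟨ cong (_* x) (×1-homo-* c p) ⟩
      ((c · 1#) * (p · 1#)) * x   ≡⟨ cong (λ z → ((c · 1#) * z) * x) p·1≡0 ⟩
      ((c · 1#) * 0#) * x         ≡⟨ cong (_* x) (zeroʳ _) ⟩
      0# * x                      ≡⟨ zeroˡ x ⟩
      0#                          ∎
      where open ≡-Reasoning

    frobenius : ∀ x y → (x + y) ^ᶠ p ≡ x ^ᶠ p + y ^ᶠ p
    frobenius x y = go p refl
      where
      go : ∀ m → m ≡ p → (x + y) ^ᶠ m ≡ x ^ᶠ m + y ^ᶠ m
      go zero refl = ⊥-elim (NonZero.nonZero (prime⇒nonZero p-prime))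
      go (suc n) refl = binomial-inner-vanish n x y (λ 0<k k<p z → p∣m⇒m·x≡0 z (prime∣pCk p-prime 0<k k<p))

    frobenius-^ : ∀ k x y → (x + y) ^ᶠ (p ℕ.^ k) ≡ x ^ᶠ (p ℕ.^ k) + y ^ᶠ (p ℕ.^ k)
    frobenius-^ zero x y = trans (*-identityʳ _) (sym (cong₂ _+_ (*-identityʳ x) (*-identityʳ y)))
    frobenius-^ (suc k) x y = begin
      (x + y) ^ᶠ (p ℕ.* p ℕ.^ k)                   ≡⟨ ^ᶠ-assocʳ (x + y) p (p ℕ.^ k) ⟨
      ((x + y) ^ᶠ p) ^ᶠ (p ℕ.^ k)                  ≡⟨ cong (_^ᶠ (p ℕ.^ k)) (frobenius x y) ⟩
      (x ^ᶠ p + y ^ᶠ p) ^ᶠ (p ℕ.^ k)               ≡⟨ frobenius-^ k (x ^ᶠ p) (y ^ᶠ p) ⟩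
      (x ^ᶠ p) ^ᶠ (p ℕ.^ k) + (y ^ᶠ p) ^ᶠ (p ℕ.^ k) ≡⟨ cong₂ _+_ (^ᶠ-assocʳ x p (p ℕ.^ k)) (^ᶠ-assocʳ y p (p ℕ.^ k)) ⟩
      x ^ᶠ (p ℕ.* p ℕ.^ k) + y ^ᶠ (p ℕ.* p ℕ.^ k)   ∎
      where open ≡-Reasoning

  -- Functional graphs

  connected-through : ∀ {f : Carrier → Carrier} {z} → (∀ x → f (f x) ≡ z) → ∀ x y → Connected f x y
  connected-through {f} {z} f²≡z x y = EqClosure.transitive (Edge f) (x⇝z x) (EqClosure.symmetric (Edge f) (x⇝z y))
    where
    x⇝z : ∀ x → Connected f x z
    x⇝z x = fwd refl ◅ fwd (f²≡z x) ◅ ε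

  periodic⇒fixed : ∀ {f : Carrier → Carrier} {z} → (∀ x → f (f x) ≡ z) → ∀ x m → iter f (suc m) x ≡ x → x ≡ z
  periodic⇒fixed {f} f²≡z x zero fx≡x = trans (sym fx≡x) (trans (cong f (sym fx≡x)) (f²≡z x))
  periodic⇒fixed {f} f²≡z x (suc m) fᵐ⁺²x≡x = trans (sym fᵐ⁺²x≡x) (f²≡z (iter f m x))

  δ₂≡0⇒c≡-a : ∀ {n a c β} → 1# + 1# ≢ 0# → β ≢ 0# → δ₂ n a c β ≡ 0# → c ≡ - a
  δ₂≡0⇒c≡-a {n} {a} {c} {β} 2≢0 β≢0 δ₂≡0 with x*y≡0⇒x≡0∨y≡0 ((a + c) * (- (1# + 1#)) ^ᶠ (n ∸ 1)) δ₂≡0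
  ... | inj₂ βⁿ⁻²≡0 = ⊥-elim (β≢0 (x^n≡0⇒x≡0 (n ∸ 2) βⁿ⁻²≡0))
  ... | inj₁ [a+c][-2]ⁿ⁻¹≡0 with x*y≡0⇒x≡0∨y≡0 (a + c) [a+c][-2]ⁿ⁻¹≡0
  ...   | inj₂ [-2]ⁿ⁻¹≡0 = ⊥-elim (2≢0 (-x≡0⇒x≡0 (x^n≡0⇒x≡0 (n ∸ 1) [-2]ⁿ⁻¹≡0)))
  ...   | inj₁ a+c≡0 = x+y≡0⇒y≡-x a+c≡0

module Subfield (K : FiniteField) (q : ℕ) where
  open import Data.Nat as ℕ using (ℕ; zero; suc; _∸_; _≤_; _<_; z≤n; s≤s)
  import Data.Nat.Properties as ℕP
  open import Data.Product using (_×_; _,_; proj₁; proj₂)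
  open import Data.Sum using (_⊎_; inj₁; inj₂)
  import Data.Sum
  open import Data.Empty using (⊥-elim)
  open import Function using (_∘_)
  open import Relation.Nullary using (¬_; yes; no)
  open import Relation.Nullary.Decidable using (_×-dec_; ¬?)
  open import Relation.Unary using (Pred; Decidable)
  open import Relation.Binary.PropositionalEquality
  open import Level using (0ℓ)
  open import Data.Nat.Divisibility using (_∣_; divides)
  open import Data.Nat.GCD using (gcd; gcd-GCD; gcd[m,n]∣m; gcd[m,n]∣n; gcd[m,n]≢0; module Bézout)
  open import Data.List.Relation.Unary.All as All using (All)
  open import Data.List.Relation.Unary.All.Properties using (all-filter)
  import Data.List.Relation.Unary.Unique.Propositional.Properties as Unique

  open FieldTheory K

  Fr : Carrier → Carrier
  Fr x = x ^ᶠ q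

  F? : Decidable (InFq q)
  F? x = Fr x ≟ x

  InV : Carrier → Set
  InV x = Fr x ≡ - x

  V? : Decidable InV
  V? x = Fr x ≟ (- x)

  T : Carrier → Carrier
  T x = Fr x - x

  Fr-* : ∀ x y → Fr (x * y) ≡ Fr x * Fr y
  Fr-* x y = ^ᶠ-distrib-* x y q

  F-1 : InFq q 1#
  F-1 = 1^ᶠ q

  F-* : ∀ {x y} → InFq q x → InFq q y → InFq q (x * y)
  F-* {x} {y} Fx Fy = trans (Fr-* x y) (cong₂ _*_ Fx Fy)

  F-^ : ∀ {x} → InFq q x → ∀ m → InFq q (x ^ᶠ m)
  F-^ Fx zero = F-1
  F-^ Fx (suc m) = F-* Fx (F-^ Fx m)

  F-cancelˡ : ∀ {x y} → x ≢ 0# → InFq q x → InFq q (x * y) → InFq q y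
  F-cancelˡ {x} {y} x≢0 Fx Fxy = *-cancelˡ x≢0 (trans (cong (_* Fr y) (sym Fx)) (trans (sym (Fr-* x y)) Fxy))

  Fr-0 : (∀ x y → Fr (x + y) ≡ Fr x + Fr y) → Fr 0# ≡ 0#
  Fr-0 Fr-+ = identityʳ-unique (Fr 0#) (Fr 0#) (sym (trans (cong Fr (sym (+-identityʳ 0#))) (Fr-+ 0# 0#)))

  x∉F∧x²∈F⇒x∈V : ∀ {x} → ¬ InFq q x → InFq q (x * x) → InV x
  x∉F∧x²∈F⇒x∈V {x} x∉F x²∈F with x*x≡y*y⇒x≡±y (trans (sym (Fr-* x x)) x²∈F)
  ... | inj₁ x∈F = ⊥-elim (x∉F x∈F)
  ... | inj₂ Frx≡-x = Frx≡-x

  module _ (Fr-+ : ∀ x y → Fr (x + y) ≡ Fr x + Fr y) (card≡q² : card ≡ q ℕ.^ 2) (2≢0 : 1# + 1# ≢ 0#)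
           {β : Carrier} (β≢0 : β ≢ 0#) (β∈V : InV β) where

    F-0 : InFq q 0#
    F-0 = Fr-0 Fr-+

    Fr-neg : ∀ x → Fr (- x) ≡ - Fr x
    Fr-neg x = inverseʳ-unique (Fr x) (Fr (- x)) (trans (sym (Fr-+ x (- x))) (trans (cong Fr (-‿inverseʳ x)) F-0))

    Fr-sub : ∀ x y → Fr (x - y) ≡ Fr x - Fr y
    Fr-sub x y = trans (Fr-+ x (- y)) (cong (Fr x +_) (Fr-neg y))

    F-+ : ∀ {x y} → InFq q x → InFq q y → InFq q (x + y)
    F-+ {x} {y} Fx Fy = trans (Fr-+ x y) (cong₂ _+_ Fx Fy)

    F-neg : ∀ {x} → InFq q x → InFq q (- x)
    F-neg {x} Fx = trans (Fr-neg x) (cong -_ Fx)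

    T-+ : ∀ x y → T (x + y) ≡ T x + T y
    T-+ x y = trans (cong (_- (x + y)) (Fr-+ x y))
      (solve 4 (λ a b x y → (a :+ b) :- (x :+ y) := (a :- x) :+ (b :- y)) refl (Fr x) (Fr y) x y)

    T≡0⇒F : ∀ {x} → T x ≡ 0# → InFq q x
    T≡0⇒F = x-y≡0⇒x≡y

    F⇒T≡0 : ∀ {x} → InFq q x → T x ≡ 0#
    F⇒T≡0 = x≈y⇒x∙y⁻¹≈ε

    Fr-involutive : ∀ x → Fr (Fr x) ≡ x
    Fr-involutive x = begin
      (x ^ᶠ q) ^ᶠ q  ≡⟨ ^ᶠ-assocʳ x q q ⟩
      x ^ᶠ (q ℕ.* q) ≡⟨ cong (λ e → x ^ᶠ (q ℕ.* e)) (ℕP.*-identityʳ q) ⟨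
      x ^ᶠ (q ℕ.^ 2) ≡⟨ cong (x ^ᶠ_) card≡q² ⟨
      x ^ᶠ card      ≡⟨ x^card≡x x ⟩
      x              ∎
      where open ≡-Reasoning

    T∈V : ∀ x → InV (T x)
    T∈V x = begin
      Fr (Fr x - x)     ≡⟨ Fr-sub (Fr x) x ⟩
      Fr (Fr x) - Fr x  ≡⟨ cong (_- Fr x) (Fr-involutive x) ⟩
      x - Fr x          ≡⟨ solve 2 (λ x y → x :- y := :- (y :- x)) refl x (Fr x) ⟩
      - (Fr x - x)      ∎
      where open ≡-Reasoning

    F-⁻¹ : ∀ {x} (x≢0 : x ≢ 0#) → InFq q x → InFq q (x ⁻¹⟨ x≢0 ⟩)
    F-⁻¹ {x} x≢0 Fx = F-cancelˡ x≢0 Fx (subst (InFq q) (sym (x*x⁻¹≡1 x x≢0)) F-1)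

    T-fibre : ∀ {w} → InV w → count (λ x → T x ≡ w) (λ x → T x ≟ w) ≡ count (InFq q) F?
    T-fibre {w} w∈V = begin
      count (λ x → T x ≡ w) (λ x → T x ≟ w)                ≡⟨ count-bijection (λ x → T x ≟ w) (_+ x₀) (_- x₀) +x₀-x₀ -x₀+x₀ ⟨
      count (λ x → T (x + x₀) ≡ w) (λ x → T (x + x₀) ≟ w)  ≡⟨ count-cong _ F? (to , from) ⟩
      count (InFq q) F?                                    ∎
      where
      open ≡-Reasoning
      ½ = (1# + 1#) ⁻¹⟨ 2≢0 ⟩
      x₀ = - (w * ½)
      +x₀-x₀ : ∀ x → x + x₀ - x₀ ≡ x
      +x₀-x₀ x = solve 2 (λ x a → (x :+ a) :- a := x) refl x x₀
      -x₀+x₀ : ∀ x → x - x₀ + x₀ ≡ x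
      -x₀+x₀ x = solve 2 (λ x a → (x :- a) :+ a := x) refl x x₀
      Tx₀≡w : T x₀ ≡ w
      Tx₀≡w = begin
        Fr (- (w * ½)) - (- (w * ½))    ≡⟨ cong (_- (- (w * ½))) (trans (Fr-neg (w * ½)) (cong -_ (Fr-* w ½))) ⟩
        - (Fr w * Fr ½) - (- (w * ½))   ≡⟨ cong (λ u → - u - (- (w * ½))) (cong₂ _*_ w∈V (F-⁻¹ 2≢0 (F-+ F-1 F-1))) ⟩
        - (- w * ½) - (- (w * ½))       ≡⟨ solve 2 (λ w h → :- (:- w :* h) :- (:- (w :* h)) := w :* (h :+ h)) refl w ½ ⟩
        w * (½ + ½)                     ≡⟨ cong (w *_) (trans (distribʳ ½ 1# 1#) (cong₂ _+_ (*-identityˡ ½) (*-identityˡ ½))) ⟨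
        w * ((1# + 1#) * ½)             ≡⟨ cong (w *_) (x*x⁻¹≡1 (1# + 1#) 2≢0) ⟩
        w * 1#                          ≡⟨ *-identityʳ w ⟩
        w                               ∎
      shifted : ∀ x → T (x + x₀) ≡ T x + w
      shifted x = trans (T-+ x x₀) (cong (T x +_) Tx₀≡w)
      to : ∀ {x} → T (x + x₀) ≡ w → InFq q x
      to {x} Tx+x₀≡w = T≡0⇒F (identityˡ-unique (T x) w (trans (sym (shifted x)) Tx+x₀≡w))
      from : ∀ {x} → InFq q x → T (x + x₀) ≡ w
      from {x} Fx = trans (shifted x) (trans (cong (_+ w) (F⇒T≡0 Fx)) (+-identityˡ w))

    count-∘β* : ∀ {P : Pred Carrier 0ℓ} (P? : Decidable P) → count (P ∘ (β *_)) (P? ∘ (β *_)) ≡ count P P?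
    count-∘β* P? = count-bijection P? (β *_) (β ⁻¹⟨ β≢0 ⟩ *_) (x⁻¹*x*y≡y β β≢0) (x*x⁻¹*y≡y β β≢0)

    Fr[βt] : ∀ t → Fr (β * t) ≡ - β * Fr t
    Fr[βt] t = trans (Fr-* β t) (cong (_* Fr t) β∈V)

    βt∈V⇒t∈F : ∀ {t} → InV (β * t) → InFq q t
    βt∈V⇒t∈F {t} βt∈V = *-cancelˡ (β≢0 ∘ -x≡0⇒x≡0) (trans (sym (Fr[βt] t)) (trans βt∈V (-‿distribˡ-* β t)))

    t∈F⇒βt∈V : ∀ {t} → InFq q t → InV (β * t)
    t∈F⇒βt∈V {t} Ft = trans (Fr[βt] t) (trans (cong (- β *_) Ft) (sym (-‿distribˡ-* β t)))

    count-V : count InV V? ≡ count (InFq q) F?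
    count-V = trans (sym (count-∘β* V?)) (count-cong _ F? (βt∈V⇒t∈F , t∈F⇒βt∈V))

    count-∘T : ∀ {Q : Pred Carrier 0ℓ} (Q? : Decidable Q) → (∀ {w} → Q w → InV w) →
      count (Q ∘ T) (Q? ∘ T) ≡ count Q Q? ℕ.* count (InFq q) F?
    count-∘T {Q} Q? Q⇒V = count-fibres-const (Q? ∘ T) Q? T (λ Q[Tx] → Q[Tx]) fibre≡
      where
      fibre≡ : ∀ {w} → Q w → count (λ x → Q (T x) × T x ≡ w) (λ x → Q? (T x) ×-dec (T x ≟ w)) ≡ count (InFq q) F?
      fibre≡ {w} Qw = trans (count-cong _ (λ x → T x ≟ w) (proj₂ , λ Tx≡w → subst Q (sym Tx≡w) Qw , Tx≡w)) (T-fibre (Q⇒V Qw))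

    count-F : count (InFq q) F? ≡ q
    count-F = NatLemmas.m*m≡n*n⇒m≡n (begin
      count (InFq q) F? ℕ.* count (InFq q) F?   ≡⟨ cong (ℕ._* count (InFq q) F?) count-V ⟨
      count InV V? ℕ.* count (InFq q) F?        ≡⟨ count-∘T V? (λ w∈V → w∈V) ⟨
      count (InV ∘ T) (V? ∘ T)                  ≡⟨ count-all (V? ∘ T) T∈V ⟩
      card                                      ≡⟨ card≡q² ⟩
      q ℕ.* (q ℕ.* 1)                           ≡⟨ cong (q ℕ.*_) (ℕP.*-identityʳ q) ⟩
      q ℕ.* q                                   ∎)
      where open ≡-Reasoning

    -- Roots of unity in F_q*

    InF* : Carrier → Set
    InF* x = InFq q x × x ≢ 0#

    F*? : Decidable InF*
    F*? x = F? x ×-dec ¬? (x ≟ 0#)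

    q≡1+|F*| : q ≡ suc (count InF* F*?)
    q≡1+|F*| = trans (sym count-F) (count-≢ F? F-0)

    count-F* : count InF* F*? ≡ q ∸ 1
    count-F* = cong (_∸ 1) (sym q≡1+|F*|)

    0<q-1 : 0 < q ∸ 1
    0<q-1 = subst (0 <_) count-F* (subst (0 <_) (sym (count-≢ F*? (F-1 , 1≢0))) (s≤s z≤n))

    F*-* : ∀ {x y} → InF* x → InF* y → InF* (x * y)
    F*-* (Fx , x≢0) (Fy , y≢0) = F-* Fx Fy , *-nonzero x≢0 y≢0

    F*-^ : ∀ {x} → InF* x → ∀ m → InF* (x ^ᶠ m)
    F*-^ (Fx , x≢0) m = F-^ Fx m , ^ᶠ-nonzero m x≢0

    x^m≡1⇒x≢0 : ∀ {x m} → 0 < m → x ^ᶠ m ≡ 1# → x ≢ 0#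
    x^m≡1⇒x≢0 0<m xᵐ≡1 refl = 1≢0 (trans (sym xᵐ≡1) (0^ᶠ 0<m))

    x^[q-1]≡1 : ∀ {x} → InF* x → x ^ᶠ (q ∸ 1) ≡ 1#
    x^[q-1]≡1 {x} (Fx , x≢0) = *-cancelˡ x≢0 (begin
      x * x ^ᶠ (q ∸ 1)  ≡⟨ cong (x ^ᶠ_) q≡1+[q-1] ⟨
      x ^ᶠ q            ≡⟨ Fx ⟩
      x                 ≡⟨ *-identityʳ x ⟨
      x * 1#            ∎)
      where
      open ≡-Reasoning
      q≡1+[q-1] : q ≡ suc (q ∸ 1)
      q≡1+[q-1] = trans q≡1+|F*| (cong suc count-F*)

    x^m≡1⇒x^[c*m]≡1 : ∀ {x m} c → x ^ᶠ m ≡ 1# → x ^ᶠ (c ℕ.* m) ≡ 1#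
    x^m≡1⇒x^[c*m]≡1 {x} {m} c xᵐ≡1 = begin
      x ^ᶠ (c ℕ.* m)   ≡⟨ cong (x ^ᶠ_) (ℕP.*-comm c m) ⟩
      x ^ᶠ (m ℕ.* c)   ≡⟨ ^ᶠ-assocʳ x m c ⟨
      (x ^ᶠ m) ^ᶠ c    ≡⟨ cong (_^ᶠ c) xᵐ≡1 ⟩
      1# ^ᶠ c          ≡⟨ 1^ᶠ c ⟩
      1#               ∎
      where open ≡-Reasoning

    x^[m+k]≡1⇒x^m≡1 : ∀ {x m k} → x ^ᶠ (m ℕ.+ k) ≡ 1# → x ^ᶠ k ≡ 1# → x ^ᶠ m ≡ 1#
    x^[m+k]≡1⇒x^m≡1 {x} {m} {k} xᵐ⁺ᵏ≡1 xᵏ≡1 = begin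
      x ^ᶠ m              ≡⟨ *-identityʳ _ ⟨
      x ^ᶠ m * 1#         ≡⟨ cong (x ^ᶠ m *_) xᵏ≡1 ⟨
      x ^ᶠ m * x ^ᶠ k     ≡⟨ ^ᶠ-homo-* x m k ⟨
      x ^ᶠ (m ℕ.+ k)      ≡⟨ xᵐ⁺ᵏ≡1 ⟩
      1#                  ∎
      where open ≡-Reasoning

    μ : ℕ → ℕ
    μ d = count (λ t → InFq q t × t ^ᶠ d ≡ 1#) (λ t → F? t ×-dec ((t ^ᶠ d) ≟ 1#))

    μ≤ : ∀ {d} → 0 < d → μ d ≤ d
    μ≤ {d} 0<d = roots-of-unity-bound _ 0<d (Unique.filter⁺ μ? elems-unique) (All.map proj₂ (all-filter μ? elems))
      where
      μ? : Decidable (λ t → InFq q t × t ^ᶠ d ≡ 1#)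
      μ? t = F? t ×-dec ((t ^ᶠ d) ≟ 1#)

    μ-gcd : ∀ {d} → 0 < d → μ d ≡ μ (gcd d (q ∸ 1))
    μ-gcd {d} 0<d = count-cong _ _ ((λ (Ft , tᵈ≡1) → Ft , to Ft tᵈ≡1) , (λ (Ft , tᵍ≡1) → Ft , from tᵍ≡1))
      where
      g = gcd d (q ∸ 1)
      to : ∀ {t} → InFq q t → t ^ᶠ d ≡ 1# → t ^ᶠ g ≡ 1#
      to {t} Ft tᵈ≡1 = bézout (Bézout.identity (gcd-GCD d (q ∸ 1)))
        where
        t^[q-1]≡1 : t ^ᶠ (q ∸ 1) ≡ 1#
        t^[q-1]≡1 = x^[q-1]≡1 (Ft , x^m≡1⇒x≢0 0<d tᵈ≡1)
        bézout : Bézout.Identity g d (q ∸ 1) → t ^ᶠ g ≡ 1#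
        bézout (Bézout.+- x y g+y[q-1]≡xd) = x^[m+k]≡1⇒x^m≡1 {m = g} {k = y ℕ.* (q ∸ 1)}
          (trans (cong (t ^ᶠ_) g+y[q-1]≡xd) (x^m≡1⇒x^[c*m]≡1 x tᵈ≡1)) (x^m≡1⇒x^[c*m]≡1 y t^[q-1]≡1)
        bézout (Bézout.-+ x y g+xd≡y[q-1]) = x^[m+k]≡1⇒x^m≡1 {m = g} {k = x ℕ.* d}
          (trans (cong (t ^ᶠ_) g+xd≡y[q-1]) (x^m≡1⇒x^[c*m]≡1 y t^[q-1]≡1)) (x^m≡1⇒x^[c*m]≡1 x tᵈ≡1)
      from : ∀ {t} → t ^ᶠ g ≡ 1# → t ^ᶠ d ≡ 1#
      from {t} tᵍ≡1 with gcd[m,n]∣m d (q ∸ 1)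
      ... | divides c d≡cg = trans (cong (t ^ᶠ_) d≡cg) (x^m≡1⇒x^[c*m]≡1 c tᵍ≡1)

    power-fibre : ∀ {γ α d} → InF* γ → InF* α → 0 < d →
      fibre F*? (λ t → γ * t ^ᶠ d) α ≡ 0 ⊎ fibre F*? (λ t → γ * t ^ᶠ d) α ≡ μ d
    power-fibre {γ} {α} {d} γ∈F* α∈F* 0<d with fibre F*? (λ t → γ * t ^ᶠ d) α ℕ.≟ 0
    ... | yes empty = inj₁ empty
    ... | no nonempty with count≢0⇒∃ (λ t → F*? t ×-dec ((γ * t ^ᶠ d) ≟ α)) nonempty
    ...   | t₀ , (t₀∈F* , γt₀ᵈ≡α) = inj₂ (begin
      fibre F*? (λ t → γ * t ^ᶠ d) α
        ≡⟨ count-bijection P? (t₀ *_) (t₀ ⁻¹⟨ t₀≢0 ⟩ *_) (x⁻¹*x*y≡y t₀ t₀≢0) (x*x⁻¹*y≡y t₀ t₀≢0) ⟨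
      count (λ t → InF* (t₀ * t) × γ * (t₀ * t) ^ᶠ d ≡ α) (P? ∘ (t₀ *_))  ≡⟨ count-cong _ _ (to , from) ⟩
      μ d                                                                  ∎)
      where
      open ≡-Reasoning
      t₀≢0 = proj₂ t₀∈F*
      P? : Decidable (λ t → InF* t × γ * t ^ᶠ d ≡ α)
      P? t = F*? t ×-dec ((γ * t ^ᶠ d) ≟ α)
      shifted : ∀ t → γ * (t₀ * t) ^ᶠ d ≡ α * t ^ᶠ d
      shifted t = trans (cong (γ *_) (^ᶠ-distrib-* t₀ t d)) (trans (sym (*-assoc γ _ _)) (cong (_* t ^ᶠ d) γt₀ᵈ≡α))
      to : ∀ {t} → InF* (t₀ * t) × γ * (t₀ * t) ^ᶠ d ≡ α → InFq q t × t ^ᶠ d ≡ 1#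
      to {t} ((Ft₀t , _) , eq) = F-cancelˡ t₀≢0 (proj₁ t₀∈F*) Ft₀t ,
        *-cancelˡ (proj₂ α∈F*) (trans (sym (shifted t)) (trans eq (sym (*-identityʳ α))))
      from : ∀ {t} → InFq q t × t ^ᶠ d ≡ 1# → InF* (t₀ * t) × γ * (t₀ * t) ^ᶠ d ≡ α
      from {t} (Ft , tᵈ≡1) = F*-* t₀∈F* (Ft , x^m≡1⇒x≢0 0<d tᵈ≡1) ,
        trans (shifted t) (trans (cong (α *_) tᵈ≡1) (*-identityʳ α))

    μ-divisor : ∀ {g} → g ∣ q ∸ 1 → 0 < g → μ g ≡ g
    μ-divisor {g} (divides e q-1≡eg) 0<g = ℕP.≤-antisym (μ≤ 0<g) (ℕP.*-cancelˡ-≤ e ⦃ ℕ.>-nonZero 0<e ⦄ (begin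
      e ℕ.* g        ≡⟨ q-1≡eg ⟨
      q ∸ 1          ≡⟨ count-F* ⟨
      count InF* F*? ≤⟨ count-fibres-≤ F*? Q? (λ t → 1# * t ^ᶠ g) g-th-power fibre≤μg ⟩
      μ e ℕ.* μ g    ≤⟨ ℕP.*-monoˡ-≤ (μ g) (μ≤ 0<e) ⟩
      e ℕ.* μ g      ∎))
      where
      open ℕP.≤-Reasoning
      0<e : 0 < e
      0<e = ℕP.n≢0⇒n>0 (λ e≡0 → ℕP.<⇒≢ 0<q-1 (sym (trans q-1≡eg (cong (ℕ._* g) e≡0))))
      Q? : Decidable (λ w → InFq q w × w ^ᶠ e ≡ 1#)
      Q? w = F? w ×-dec ((w ^ᶠ e) ≟ 1#)
      g-th-power : ∀ {t} → InF* t → InFq q (1# * t ^ᶠ g) × (1# * t ^ᶠ g) ^ᶠ e ≡ 1#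
      g-th-power {t} t∈F* = F-* F-1 (F-^ (proj₁ t∈F*) g) ,
        trans (cong (_^ᶠ e) (*-identityˡ _)) (trans (^ᶠ-assocʳ t g e)
          (trans (cong (t ^ᶠ_) (trans (ℕP.*-comm g e) (sym q-1≡eg))) (x^[q-1]≡1 t∈F*)))
      fibre≤μg : ∀ {w} → InFq q w × w ^ᶠ e ≡ 1# → fibre F*? (λ t → 1# * t ^ᶠ g) w ≤ μ g
      fibre≤μg (Fw , wᵉ≡1) with power-fibre (F-1 , 1≢0) (Fw , x^m≡1⇒x≢0 0<e wᵉ≡1) 0<g
      ... | inj₁ empty = ℕP.≤-trans (ℕP.≤-reflexive empty) z≤n
      ... | inj₂ full = ℕP.≤-reflexive full

    count-power-fibres : ∀ {γ n} → InF* γ → 0 < n → let g = gcd n (q ∸ 1) in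
      count (λ α → InF* α × fibre F*? (λ t → γ * t ^ᶠ n) α ≡ g)
            (λ α → F*? α ×-dec (fibre F*? (λ t → γ * t ^ᶠ n) α ℕ.≟ g)) ℕ.* g ≡ q ∸ 1
    count-power-fibres {γ} {n} γ∈F* 0<n =
      trans (sym (count-fibres-0-or F*? F*? (λ t → γ * t ^ᶠ n) (λ t∈F* → F*-* γ∈F* (F*-^ t∈F* n)) fibre-0-or-g)) count-F*
      where
      g = gcd n (q ∸ 1)
      0<g : 0 < g
      0<g = ℕP.n≢0⇒n>0 (gcd[m,n]≢0 n (q ∸ 1) (inj₁ (ℕP.>⇒≢ 0<n)))
      μn≡g : μ n ≡ g
      μn≡g = trans (μ-gcd 0<n) (μ-divisor (gcd[m,n]∣n n (q ∸ 1)) 0<g)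
      fibre-0-or-g : ∀ {α} → InF* α → fibre F*? (λ t → γ * t ^ᶠ n) α ≡ 0 ⊎ fibre F*? (λ t → γ * t ^ᶠ n) α ≡ g
      fibre-0-or-g α∈F* = Data.Sum.map₂ (λ full → trans full μn≡g) (power-fibre γ∈F* α∈F* 0<n)

    -- The map f = -a Tⁿ

    V^even∈F : ∀ {w n} → 2 ∣ n → InV w → InFq q (w ^ᶠ n)
    V^even∈F {w} (divides m refl) w∈V =
      subst (InFq q) (trans (^ᶠ-assocʳ w 2 m) (cong (w ^ᶠ_) (ℕP.*-comm 2 m))) (F-^ w²∈F m)
      where
      w²∈F : InFq q (w ^ᶠ 2)
      w²∈F = begin
        Fr (w * (w * 1#))         ≡⟨ ^ᶠ-distrib-* w (w * 1#) q ⟩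
        Fr w * Fr (w * 1#)        ≡⟨ cong (Fr w *_) (^ᶠ-distrib-* w 1# q) ⟩
        Fr w * (Fr w * Fr 1#)     ≡⟨ cong₂ (λ u v → u * (u * v)) w∈V F-1 ⟩
        - w * (- w * 1#)          ≡⟨ solve 2 (λ w u → :- w :* (:- w :* u) := w :* (w :* u)) refl w 1# ⟩
        w * (w * 1#)              ∎
        where open ≡-Reasoning

    module MapThroughT {n} (2∣n : 2 ∣ n) (2≤n : 2 ≤ n) {a c} (a∈F : InFq q a) (a≢0 : a ≢ 0#) (c≡-a : c ≡ - a) where

      f : Carrier → Carrier
      f = fMap q n a c

      0<n : 0 < n
      0<n = ℕP.<-≤-trans (s≤s z≤n) 2≤n

      f≡-aTⁿ : ∀ x → f x ≡ - a * T x ^ᶠ n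
      f≡-aTⁿ x = begin
        (c * Fr x + a * x) * T x ^ᶠ (n ∸ 1)    ≡⟨ cong (λ c → (c * Fr x + a * x) * T x ^ᶠ (n ∸ 1)) c≡-a ⟩
        (- a * Fr x + a * x) * T x ^ᶠ (n ∸ 1)
          ≡⟨ cong (_* T x ^ᶠ (n ∸ 1)) (solve 3 (λ a u x → :- a :* u :+ a :* x := :- a :* (u :- x)) refl a (Fr x) x) ⟩
        - a * T x * T x ^ᶠ (n ∸ 1)             ≡⟨ *-assoc _ _ _ ⟩
        - a * T x ^ᶠ suc (n ∸ 1)               ≡⟨ cong (λ m → - a * T x ^ᶠ m) (ℕP.m+[n∸m]≡n {1} {n} 0<n) ⟩
        - a * T x ^ᶠ n                         ∎
        where open ≡-Reasoning

      f∈F : ∀ x → InFq q (f x)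
      f∈F x = subst (InFq q) (sym (f≡-aTⁿ x)) (F-* (F-neg a∈F) (V^even∈F 2∣n (T∈V x)))

      f-on-F : ∀ {x} → InFq q x → f x ≡ 0#
      f-on-F {x} Fx = trans (f≡-aTⁿ x) (trans (cong (λ t → - a * t ^ᶠ n) (F⇒T≡0 Fx)) (trans (cong (- a *_) (0^ᶠ 0<n)) (zeroʳ _)))

      f≡0⇒F : ∀ {x} → f x ≡ 0# → InFq q x
      f≡0⇒F {x} fx≡0 with x*y≡0⇒x≡0∨y≡0 (- a) (trans (sym (f≡-aTⁿ x)) fx≡0)
      ... | inj₁ -a≡0 = ⊥-elim (a≢0 (-x≡0⇒x≡0 -a≡0))
      ... | inj₂ Tⁿ≡0 = T≡0⇒F (x^n≡0⇒x≡0 n Tⁿ≡0)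

      f∘f≡0 : ∀ x → f (f x) ≡ 0#
      f∘f≡0 x = f-on-F (f∈F x)

      γ : Carrier
      γ = - a * β ^ᶠ n

      γ∈F* : InF* γ
      γ∈F* = F-* (F-neg a∈F) (V^even∈F 2∣n β∈V) , *-nonzero (a≢0 ∘ -x≡0⇒x≡0) (^ᶠ-nonzero n β≢0)

      preimageSize-f : ∀ α →
        preimageSize f α ≡ count (λ t → InFq q t × γ * t ^ᶠ n ≡ α) (λ t → F? t ×-dec ((γ * t ^ᶠ n) ≟ α)) ℕ.* q
      preimageSize-f α = begin
        count (λ x → f x ≡ α) (λ x → f x ≟ α)   ≡⟨ count-cong _ (Q? ∘ T) (fx≡α⇒Q[Tx] , Q[Tx]⇒fx≡α) ⟩
        count (Q ∘ T) (Q? ∘ T)                   ≡⟨ count-∘T Q? proj₁ ⟩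
        count Q Q? ℕ.* count (InFq q) F?         ≡⟨ cong₂ ℕ._*_ (sym (count-∘β* Q?)) count-F ⟩
        count (Q ∘ (β *_)) (Q? ∘ (β *_)) ℕ.* q   ≡⟨ cong (ℕ._* q) (count-cong _ _ (to , from)) ⟩
        count (λ t → InFq q t × γ * t ^ᶠ n ≡ α) (λ t → F? t ×-dec ((γ * t ^ᶠ n) ≟ α)) ℕ.* q ∎
        where
        open ≡-Reasoning
        Q : Carrier → Set
        Q w = InV w × - a * w ^ᶠ n ≡ α
        Q? : Decidable Q
        Q? w = V? w ×-dec ((- a * w ^ᶠ n) ≟ α)
        fx≡α⇒Q[Tx] : ∀ {x} → f x ≡ α → Q (T x)
        fx≡α⇒Q[Tx] {x} fx≡α = T∈V x , trans (sym (f≡-aTⁿ x)) fx≡α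
        Q[Tx]⇒fx≡α : ∀ {x} → Q (T x) → f x ≡ α
        Q[Tx]⇒fx≡α {x} (_ , -aTxⁿ≡α) = trans (f≡-aTⁿ x) -aTxⁿ≡α
        scaled : ∀ t → - a * (β * t) ^ᶠ n ≡ γ * t ^ᶠ n
        scaled t = trans (cong (- a *_) (^ᶠ-distrib-* β t n)) (sym (*-assoc _ _ _))
        to : ∀ {t} → Q (β * t) → InFq q t × γ * t ^ᶠ n ≡ α
        to {t} (βt∈V , eq) = βt∈V⇒t∈F βt∈V , trans (sym (scaled t)) eq
        from : ∀ {t} → InFq q t × γ * t ^ᶠ n ≡ α → Q (β * t)
        from {t} (Ft , eq) = t∈F⇒βt∈V Ft , trans (scaled t) eq

      count-f⁻¹[0] : count (λ x → f x ≡ 0# × x ≢ 0#) (λ x → (f x ≟ 0#) ×-dec ¬? (x ≟ 0#)) ≡ q ∸ 1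
      count-f⁻¹[0] = trans (count-cong _ F*? ((λ (fx≡0 , x≢0) → f≡0⇒F fx≡0 , x≢0) , (λ (Fx , x≢0) → f-on-F Fx , x≢0)))
        count-F*

      preimageSize-f-nonzero : ∀ {α} → α ≢ 0# → preimageSize f α ≡ fibre F*? (λ t → γ * t ^ᶠ n) α ℕ.* q
      preimageSize-f-nonzero {α} α≢0 = trans (preimageSize-f α) (cong (ℕ._* q) (count-cong _ _ (to , from)))
        where
        to : ∀ {t} → InFq q t × γ * t ^ᶠ n ≡ α → InF* t × γ * t ^ᶠ n ≡ α
        to {t} (Ft , γtⁿ≡α) = (Ft , t≢0) , γtⁿ≡α
          where
          t≢0 : t ≢ 0#
          t≢0 refl = α≢0 (trans (sym γtⁿ≡α) (trans (cong (γ *_) (0^ᶠ 0<n)) (zeroʳ γ)))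
        from : ∀ {t} → InF* t × γ * t ^ᶠ n ≡ α → InFq q t × γ * t ^ᶠ n ≡ α
        from ((Ft , _) , γtⁿ≡α) = Ft , γtⁿ≡α

      count-full-preimages : let g = gcd n (q ∸ 1) in
        count (λ x → (f x ≡ 0# × x ≢ 0#) × preimageSize f x ≡ q ℕ.* g)
              (λ x → ((f x ≟ 0#) ×-dec ¬? (x ≟ 0#)) ×-dec (preimageSize f x ℕ.≟ q ℕ.* g)) ℕ.* g ≡ q ∸ 1
      count-full-preimages = trans (cong (ℕ._* g) (count-cong _ _ (to , from))) (count-power-fibres γ∈F* 0<n)
        where
        g = gcd n (q ∸ 1)
        instance
          q≢0 : ℕ.NonZero q
          q≢0 = subst ℕ.NonZero (sym q≡1+|F*|) _
        to : ∀ {α} → (f α ≡ 0# × α ≢ 0#) × preimageSize f α ≡ q ℕ.* g → InF* α × fibre F*? (λ t → γ * t ^ᶠ n) α ≡ g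
        to ((fα≡0 , α≢0) , size≡qg) = (f≡0⇒F fα≡0 , α≢0) ,
          ℕP.*-cancelʳ-≡ _ g q (trans (sym (preimageSize-f-nonzero α≢0)) (trans size≡qg (ℕP.*-comm q g)))
        from : ∀ {α} → InF* α × fibre F*? (λ t → γ * t ^ᶠ n) α ≡ g → (f α ≡ 0# × α ≢ 0#) × preimageSize f α ≡ q ℕ.* g
        from ((Fα , α≢0) , fibre≡g) = (f-on-F Fα , α≢0) ,
          trans (preimageSize-f-nonzero α≢0) (trans (cong (ℕ._* q) fibre≡g) (ℕP.*-comm g q))

open import Data.Nat using (ℕ; suc; _≤_; _∸_; _^_; _/_) renaming (_*_ to _*ℕ_; _≟_ to _≟ℕ_)
open import Data.Nat.Divisibility using (_∣_)
open import Data.Nat.GCD using (gcd)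
open import Data.Nat.Primality using (Prime)
open import Data.Product using (_×_; _,_)
open import Relation.Nullary using (¬_)
open import Relation.Nullary.Decidable using (_×-dec_; ¬?)
open import Relation.Binary.PropositionalEquality using (_≡_; _≢_; sym; trans; cong; subst)
import Data.Nat.Properties as ℕP

mainTheorem2 : (p k q : ℕ) → Prime p → p ≢ 2 → 1 ≤ k → q ≡ p ^ k →
  (K : FiniteField) → let open FF K in
  card ≡ q ^ 2 →
  (n : ℕ) → 2 ∣ n → 2 ≤ n →
  (a c : Carrier) → InFq q a → InFq q c → ¬ (a ≡ 0# × c ≡ 0#) →
  (β : Carrier) → ¬ InFq q β → InFq q (β * β) →
  δ₂ n a c β ≡ 0# →
  let f = fMap q n a c
      g = gcd n (q ∸ 1)
  in
  -- exactly one connected component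
  (∀ x y → Connected f x y)
  -- the only cycle is the fixed point 0
  × f 0# ≡ 0#
  × (∀ x m → iter f (suc m) x ≡ x → x ≡ 0#)
  -- q - 1 other vertices are directed to 0
  × count (λ x → f x ≡ 0# × x ≢ 0#) (λ x → (f x ≟ 0#) ×-dec ¬? (x ≟ 0#)) ≡ q ∸ 1
  -- (q - 1)/g(n) of them have preimage of size exactly q g(n)
  × count (λ x → (f x ≡ 0# × x ≢ 0#) × preimageSize f x ≡ q *ℕ g)
          (λ x → ((f x ≟ 0#) ×-dec ¬? (x ≟ 0#)) ×-dec (preimageSize f x ≟ℕ q *ℕ g))
      *ℕ g ≡ q ∸ 1
mainTheorem2 p k q p-prime p≢2 _ q≡pᵏ K card≡q² n 2∣n 2≤n a c a∈F _ a,c≢0 β β∉F β²∈F δ₂≡0 =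
  connected-through {f = f} f∘f≡0 ,
  f-on-F (Fr-0 Fr-+) ,
  periodic⇒fixed {f = f} f∘f≡0 ,
  count-f⁻¹[0] ,
  count-full-preimages
  where
  open FieldTheory K
  open Subfield K q
  p·1≡0 : p · 1# ≡ 0#
  p·1≡0 = card≡pᵉ⇒p·1≡0 {e = k *ℕ 2} (trans card≡q² (trans (cong (_^ 2) q≡pᵏ) (ℕP.^-*-assoc p k 2)))
  Fr-+ : ∀ x y → (x + y) ^ᶠ q ≡ x ^ᶠ q + y ^ᶠ q
  Fr-+ x y = subst (λ e → (x + y) ^ᶠ e ≡ x ^ᶠ e + y ^ᶠ e) (sym q≡pᵏ) (Characteristic.frobenius-^ p-prime p·1≡0 k x y)
  2≢0 : 1# + 1# ≢ 0#
  2≢0 = odd-characteristic⇒2≢0 (p / 2) (subst (λ m → m · 1# ≡ 0#) (NatLemmas.odd-prime p-prime p≢2) p·1≡0)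
  β≢0 : β ≢ 0#
  β≢0 β≡0 = β∉F (subst (InFq q) (sym β≡0) (Fr-0 Fr-+))
  c≡-a : c ≡ - a
  c≡-a = δ₂≡0⇒c≡-a {n} 2≢0 β≢0 δ₂≡0
  a≢0 : a ≢ 0#
  a≢0 a≡0 = a,c≢0 (a≡0 , trans c≡-a (trans (cong -_ a≡0) -0#≈0#))
  open MapThroughT Fr-+ card≡q² 2≢0 β≢0 (x∉F∧x²∈F⇒x∈V β∉F β²∈F) 2∣n 2≤n a∈F a≢0 c≡-a
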